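{- Let $\lambda\vdash n$, $M\in\operatorname{SSYT}(\lambda)$, and let $T$ be a filling of $\lambda$ by $1,\ldots,n$ with each number used once. Regard $p_{M,T}$ as an element of $\mathbb{Q}[x_1,\ldots,x_{n+1}]$. Then $F_{\hat\iota M,\iota T}=\varepsilon_{\iota T}p_{M,T}/s_{\hat\iota M,\iota T}$, and substituting $x_{n+1}=0$ in $F_{\hat\iota M,\iota T}$ yields $F_{M,T}$.
   Context: $S_m$ acts on $\mathbb{Q}[x_1,\ldots,x_m]$ by permuting variables. $\operatorname{SSYT}(\lambda)$ is the set of semistandard fillings of the Ferrers diagram of $\lambda$ by non-negative integers (rows weakly increasing, columns strictly increasing). For a filling $T$ of a shape of size $m$ by $1,\ldots,m$, each used once, $R(T)$ and $C(T)$ are the row and column stabilizers in $S_m$, and $\varepsilon_T=\sum_{\sigma\in C(T)}\sum_{\tau\in R(T)}\operatorname{sgn}(\sigma)\sigma\tau$. For a semistandard $M$ of the same shape: - $p_{M,T}=\prod_{i=1}^m x_i^{h_i}$, where $h_i$ is the entry of $M$ in the box of $T$ containing $i$; - $s_{M,T}$ is the number of $\tau\in R(T)$ fixing $p_{M,T}$; - $F_{M,T}=\varepsilon_Tp_{M,T}/s_{M,T}$. $\iota T$ is obtained from $T$ by adding a box at the end of the first row containing $n+1$. $\hat\iota M$ is the semistandard tableau of shape $\lambda$ with a box added to the first row, obtained by shifting all entries of the first row of $M$ one box to the right and putting $0$ in the upper left box. -}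

module Defs where

open import Data.Nat as ℕ using (ℕ; zero; suc; _≤_; _<_; _≟_; _<ᵇ_)
open import Data.Bool using (Bool; true; false; if_then_else_; _∧_)
open import Data.Fin as Fin using (Fin; toℕ)
open import Data.Vec as Vec using (Vec; []; _∷_; tabulate; lookup)
open import Data.List as List using (List; []; _∷_; _++_; map; concat; concatMap; length; filter; upTo; allFin; zip; zipWith)
open import Data.Nat.ListAction using (sum)
open import Data.Bool.ListAction using (all; any)
open import Data.List.Relation.Unary.All using (All)
open import Data.List.Relation.Unary.AllPairs using (AllPairs)
open import Data.List.Relation.Binary.Permutation.Propositional using (_↭_)
open import Data.Product using (_×_; _,_; proj₁; proj₂)
open import Data.Rational as ℚ using (ℚ; 0ℚ; 1ℚ; -_; _*_; _+_)
open import Data.Integer using (+_)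
open import Relation.Binary.PropositionalEquality using (_≡_)
open import Relation.Nullary using (Dec; yes; no; does; ¬_)
open import Data.Vec.Properties using (≡-dec)
open import Data.Fin.Properties using () renaming (_≟_ to _≟F_)

record IsPartitionOf (λ′ : List ℕ) (n : ℕ) : Set where
  field
    positive  : All (λ k → 1 ≤ k) λ′
    decreasing : AllPairs (λ a b → b ≤ a) λ′
    size      : sum λ′ ≡ n

-- A filling of a Ferrers diagram is given row by row.
Filling : Set
Filling = List (List ℕ)

shape : Filling → List ℕ
shape = map length

IsStandardFilling : List ℕ → ℕ → Filling → Set
IsStandardFilling λ′ n T = (shape T ≡ λ′) × (concat T ↭ map suc (upTo n))

nth : List ℕ → ℕ → List ℕ
nth [] _ = []
nth (x ∷ xs) zero = x ∷ []
nth (x ∷ xs) (suc j) = nth xs j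

column : Filling → ℕ → List ℕ
column M j = concatMap (λ row → nth row j) M

IsSSYT : List ℕ → Filling → Set
IsSSYT λ′ M =
  (shape M ≡ λ′) ×
  (All (AllPairs _≤_) M) ×
  (∀ j → AllPairs _<_ (column M j))

ι : ℕ → Filling → Filling
ι n [] = (suc n ∷ []) ∷ []
ι n (r ∷ rs) = (r ++ suc n ∷ []) ∷ rs

ιhat : Filling → Filling
ιhat [] = (0 ∷ []) ∷ []
ιhat (r ∷ rs) = (0 ∷ r) ∷ rs

-- a monomial ∏ x_{i+1}^{e_i} is its exponent vector
Mon : ℕ → Set
Mon m = Vec ℕ m

-- a polynomial is a finite formal sum of terms c·x^e
Poly : ℕ → Set
Poly m = List (ℚ × Mon m)

coeff : ∀ {m} → Poly m → Mon m → ℚ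
coeff [] e = 0ℚ
coeff ((c , e′) ∷ p) e with ≡-dec _≟_ e′ e
... | yes _ = c + coeff p e
... | no  _ = coeff p e

infix 4 _≈P_
_≈P_ : ∀ {m} → Poly m → Poly m → Set
p ≈P q = ∀ e → coeff p e ≡ coeff q e

scale : ∀ {m} → ℚ → Poly m → Poly m
scale a = map (λ t → a * proj₁ t , proj₂ t)

lastV : ∀ {m} → Vec ℕ (suc m) → ℕ
lastV (x ∷ []) = x
lastV (x ∷ y ∷ xs) = lastV (y ∷ xs)

dropLastV : ∀ {m} → Vec ℕ (suc m) → Vec ℕ m
dropLastV (x ∷ []) = []
dropLastV (x ∷ y ∷ xs) = x ∷ dropLastV (y ∷ xs)

setLastZero : ∀ {m} → Poly (suc m) → Poly m
setLastZero [] = []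
setLastZero ((c , e) ∷ p) with lastV e
... | zero  = (c , dropLastV e) ∷ setLastZero p
... | suc _ = setLastZero p

-- maps {1..m} → {1..m}, encoded on indices 0..m-1 as vectors
allVecs : (k m : ℕ) → List (Vec (Fin m) k)
allVecs zero m = [] ∷ []
allVecs (suc k) m = concatMap (λ v → map (λ i → i ∷ v) (allFin m)) (allVecs k m)

eqF : ∀ {m} → Fin m → Fin m → Bool
eqF i j = does (i ≟F j)

isInjective : ∀ {m} → Vec (Fin m) m → Bool
isInjective {m} σ =
  all (λ i → all (λ j → eqF i j ∨′ (Data.Bool.not (eqF (lookup σ i) (lookup σ j)))) (allFin m)) (allFin m)
  where open import Data.Bool using (not) renaming (_∨_ to _∨′_)

Sym : (m : ℕ) → List (Vec (Fin m) m)
Sym m = filter (λ σ → isInjective σ ≟B true) (allVecs m m)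
  where open import Data.Bool.Properties using () renaming (_≟_ to _≟B_)

inversions : ∀ {m} → Vec (Fin m) m → ℕ
inversions {m} σ =
  List.length (filter (λ ij → (toℕ (proj₁ ij) <ᵇ toℕ (proj₂ ij)) ∧ (toℕ (lookup σ (proj₂ ij)) <ᵇ toℕ (lookup σ (proj₁ ij))) ≟B true)
    (List.cartesianProduct (allFin m) (allFin m)))
  where open import Data.Bool.Properties using () renaming (_≟_ to _≟B_)

sgn : ∀ {m} → Vec (Fin m) m → ℚ
sgn σ = go (inversions σ)
  where
  go : ℕ → ℚ
  go zero = 1ℚ
  go (suc k) = - go k

-- σ sends x_i to x_{σ(i)}; on monomials: new exponent at j is Σ_{σ(i)=j} e_i
actMon : ∀ {m} → Vec (Fin m) m → Mon m → Mon m
actMon {m} σ e =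
  tabulate (λ j → sum (map (λ i → if eqF (lookup σ i) j then lookup e i else 0) (allFin m)))

act : ∀ {m} → Vec (Fin m) m → Poly m → Poly m
act σ = map (λ t → proj₁ t , actMon σ (proj₂ t))

-- index of the first row (resp. column) containing the label a
-- (returns a value ≥ number of rows if absent)
findIdx : List ℕ → ℕ → ℕ
findIdx [] a = 0
findIdx (x ∷ xs) a = if does (x ≟ a) then 0 else suc (findIdx xs a)

member : List ℕ → ℕ → Bool
member xs a = any (λ x → does (x ≟ a)) xs

rowOf : Filling → ℕ → ℕ
rowOf [] a = 0
rowOf (r ∷ rs) a = if member r a then 0 else suc (rowOf rs a)

colOf : Filling → ℕ → ℕ
colOf [] a = 0
colOf (r ∷ rs) a = if member r a then findIdx r a else colOf rs a

-- variable index i : Fin m stands for the number toℕ i + 1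
label : ∀ {m} → Fin m → ℕ
label i = suc (toℕ i)

preserves : ∀ {m} → (ℕ → ℕ) → Vec (Fin m) m → Bool
preserves {m} f σ = all (λ i → does (f (label (lookup σ i)) ≟ f (label i))) (allFin m)

R : (m : ℕ) → Filling → List (Vec (Fin m) m)
R m T = filter (λ σ → preserves (rowOf T) σ ≟B true) (Sym m)
  where open import Data.Bool.Properties using () renaming (_≟_ to _≟B_)

C : (m : ℕ) → Filling → List (Vec (Fin m) m)
C m T = filter (λ σ → preserves (colOf T) σ ≟B true) (Sym m)
  where open import Data.Bool.Properties using () renaming (_≟_ to _≟B_)

ε : (m : ℕ) → Filling → Poly m → Poly m
ε m T p = concatMap (λ σ → concatMap (λ τ → scale (sgn σ) (act σ (act τ p))) (R m T)) (C m T)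

-- entry of M in the box of T containing label a (0 if a does not occur)
entryAt : Filling → Filling → ℕ → ℕ
entryAt M T a = go (concat (zipWith zip T M))
  where
  go : List (ℕ × ℕ) → ℕ
  go [] = 0
  go ((b , h) ∷ ps) = if does (b ≟ a) then h else go ps

pMon : (m : ℕ) → Filling → Filling → Mon m
pMon m M T = tabulate (λ i → entryAt M T (label i))

p : (m : ℕ) → Filling → Filling → Poly m
p m M T = (1ℚ , pMon m M T) ∷ []

s : (m : ℕ) → Filling → Filling → ℕ
s m M T = length (filter (λ τ → ≡-dec _≟_ (actMon τ (pMon m M T)) (pMon m M T)) (R m T))

-- 1/k  (s_{M,T} ≥ 1 always, since the identity fixes p_{M,T})
inv : ℕ → ℚ
inv zero = 0ℚ
inv (suc k) = + 1 ℚ./ suc k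

F : (m : ℕ) → Filling → Filling → Poly m
F m M T = scale (inv (s m M T)) (ε m T (p m M T))

module Submission where

-- The row group R(ιT) is the disjoint union of the cosets R(T) ∘ (a n+1), a running over the first
-- row of ιT and R(T) embedded in S_{n+1} as permutations fixing n+1; the column group C(ιT) is C(T),
-- because n+1 is alone in its column. The monomial p_{ι̂M,ιT} is obtained from p_{M,T} (in which
-- x_{n+1} has exponent 0) by cyclically shifting the exponents along the first row of ιT, and such a
-- row permutation changes neither ε_{ιT} p nor s; this is the first identity. Setting x_{n+1} = 0 in
-- ε_{ιT} p_{M,T} kills exactly the cosets whose a carries a non-zero exponent, and each surviving
-- coset contributes ε_T p_{M,T}, so the result is K · ε_T p_{M,T}, where K counts the boxes in the
-- first row of ιT whose label has exponent 0 in p_{M,T}. The same coset decomposition gives s_{ι̂M,ιT} = K · s_{M,T}, and the factors K cancel.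

open import Defs

open import Algebra.Core using (Op₂)
open import Algebra.Structures using (IsSemiring; IsCommutativeRing)
open import Data.Bool as Bool using (Bool; true; false; if_then_else_; _∨_; _∧_; not)
open import Data.Bool.ListAction using (all)
import Data.Bool.Properties as BoolP
open import Data.Empty using (⊥-elim)
open import Data.Fin as Fin using (Fin; zero; suc; toℕ; inject₁; fromℕ; fromℕ<)
open import Data.Fin.Permutation.Components using (transpose)
import Data.Fin.Properties as FinP
open import Data.Fin.Relation.Unary.Top using (view; ‵fromℕ; ‵inject₁)
import Data.Integer as ℤ
import Data.Integer.Properties as ℤP
open import Data.List as List
  using (List; []; _∷_; _++_; map; filter; concat; concatMap; cartesianProduct; allFin; zip; length; upTo; foldr)
open import Data.List.Membership.Propositional using (_∈_; _∉_)
import Data.List.Membership.Propositional.Properties as ∈P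
open import Data.List.Membership.Propositional.Properties.WithK using (unique∧set⇒bag)
import Data.List.Properties as ListP
open import Data.List.Relation.Binary.BagAndSetEquality using (∼bag⇒↭)
open import Data.List.Relation.Binary.Permutation.Propositional using (_↭_; ↭-sym; ↭⇒↭ₛ)
import Data.List.Relation.Binary.Permutation.Propositional.Properties as ↭P
import Data.List.Relation.Binary.Permutation.Setoid.Properties as ↭ₛP
open import Data.List.Relation.Unary.All as All using (All; []; _∷_)
import Data.List.Relation.Unary.All.Properties as AllP
open import Data.List.Relation.Unary.AllPairs using ([]; _∷_)
open import Data.List.Relation.Unary.Any using (here; there)
open import Data.List.Relation.Unary.Unique.Propositional using (Unique)
import Data.List.Relation.Unary.Unique.Propositional.Properties as UniqueP
open import Data.Nat as ℕ using (ℕ; zero; suc; _+_; _*_; _≤_; _<_; z≤n; s≤s)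
open import Data.Nat.ListAction using (sum)
import Data.Nat.Properties as ℕP
open import Algebra.Properties.CommutativeMonoid.Sum ℕP.+-0-commutativeMonoid
  using (sum-syntax; ∑-comm; sum-init-last; sum-cong-≗; sum-replicate-zero)
open import Data.Product using (_×_; _,_; proj₁; proj₂; ∃)
open import Data.Rational as ℚ using (ℚ; 0ℚ; 1ℚ)
import Data.Rational.Properties as ℚP
import Data.Rational.Unnormalised as ℚᵘ
import Data.Rational.Unnormalised.Properties as ℚᵘP
open import Data.Sum using (inj₁; inj₂)
open import Data.Vec as Vec using (Vec; []; _∷_; lookup; tabulate; _∷ʳ_)
open import Data.Vec.Properties using (≡-dec)
import Data.Vec.Properties as VecP
open import Function using (_∘_; id; _⇔_; mk⇔; Equivalence)
open import Function.Definitions using (Injective)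
open import Level using (0ℓ)
open import Relation.Binary.Construct.Closure.ReflexiveTransitive as Star using (Star; _◅_; _◅◅_; fold)
open import Relation.Binary.PropositionalEquality
open import Relation.Nullary using (Dec; yes; no; does)
open import Relation.Nullary.Decidable using (dec-true; dec-false; does-⇔)
open import Relation.Unary using (Pred; Decidable)

private variable m n : ℕ

module SemiringSum {A : Set} {_⊕_ _⊗_ : Op₂ A} {0# 1# : A}
                   (isSemiring : IsSemiring _≡_ _⊕_ _⊗_ 0# 1#) where

  open IsSemiring isSemiring
    using (+-isCommutativeMonoid; +-identityˡ; +-assoc; zeroʳ; zeroˡ; *-identityˡ; distribˡ; distribʳ)

  ∑ : {X : Set} → List X → (X → A) → A
  ∑ xs h = foldr _⊕_ 0# (map h xs)

  ∑-cong : {X : Set} (xs : List X) {g h : X → A} → (∀ {x} → x ∈ xs → g x ≡ h x) → ∑ xs g ≡ ∑ xs h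
  ∑-cong []       eq = refl
  ∑-cong (x ∷ xs) eq = cong₂ _⊕_ (eq (here refl)) (∑-cong xs (eq ∘ there))

  ∑-++ : {X : Set} (xs ys : List X) (h : X → A) → ∑ (xs ++ ys) h ≡ ∑ xs h ⊕ ∑ ys h
  ∑-++ []       ys h = sym (+-identityˡ _)
  ∑-++ (x ∷ xs) ys h = trans (cong (h x ⊕_) (∑-++ xs ys h)) (sym (+-assoc _ _ _))

  ∑-map : {X Y : Set} (f : X → Y) (xs : List X) (h : Y → A) → ∑ (map f xs) h ≡ ∑ xs (h ∘ f)
  ∑-map f xs h = cong (foldr _⊕_ 0#) (sym (ListP.map-∘ xs))

  ∑-concatMap : {X Y : Set} (F : X → List Y) (xs : List X) (h : Y → A) →
                ∑ (concatMap F xs) h ≡ ∑ xs (λ x → ∑ (F x) h)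
  ∑-concatMap F []       h = refl
  ∑-concatMap F (x ∷ xs) h = trans (∑-++ (F x) (concatMap F xs) h) (cong (∑ (F x) h ⊕_) (∑-concatMap F xs h))

  ∑-cartesianProduct : {X Y : Set} (xs : List X) (ys : List Y) (h : X × Y → A) →
                       ∑ (cartesianProduct xs ys) h ≡ ∑ xs (λ x → ∑ ys (λ y → h (x , y)))
  ∑-cartesianProduct []       ys h = refl
  ∑-cartesianProduct (x ∷ xs) ys h =
    trans (∑-++ (map (x ,_) ys) _ h) (cong₂ _⊕_ (∑-map (x ,_) ys h) (∑-cartesianProduct xs ys h))

  ∑-↭ : {X : Set} {xs ys : List X} (h : X → A) → xs ↭ ys → ∑ xs h ≡ ∑ ys h
  ∑-↭ h p = ↭ₛP.foldr-commMonoid (setoid A) +-isCommutativeMonoid (↭⇒↭ₛ (↭P.map⁺ h p))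

  ∑-reindex : {X Y : Set} {xs : List X} {ys : List Y} → Unique xs → Unique ys →
              (f : X → Y) → (∀ {x x′} → f x ≡ f x′ → x ≡ x′) →
              (∀ {x} → x ∈ xs → f x ∈ ys) → (∀ {y} → y ∈ ys → ∃ λ x → x ∈ xs × f x ≡ y) →
              (h : Y → A) → ∑ ys h ≡ ∑ xs (h ∘ f)
  ∑-reindex {xs = xs} {ys} uxs uys f f-inj into onto h =
    trans (∑-↭ h (∼bag⇒↭ (unique∧set⇒bag uys (UniqueP.map⁺ f-inj uxs) (mk⇔ to from))))
          (∑-map f xs h)
    where
    to : ∀ {y} → y ∈ ys → y ∈ map f xs
    to y∈ys with x , x∈xs , refl ← onto y∈ys = ∈P.∈-map⁺ f x∈xs
    from : ∀ {y} → y ∈ map f xs → y ∈ ys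
    from y∈ with x , x∈xs , refl ← ∈P.∈-map⁻ f y∈ = into x∈xs

  ∑-involution : {X : Set} {xs : List X} → Unique xs → (φ : X → X) → (∀ x → φ (φ x) ≡ x) →
                 (∀ {x} → x ∈ xs → φ x ∈ xs) → (h : X → A) → ∑ xs h ≡ ∑ xs (h ∘ φ)
  ∑-involution u φ φ-invol into =
    ∑-reindex u u φ (λ {x} {x′} e → trans (sym (φ-invol x)) (trans (cong φ e) (φ-invol x′)))
              into (λ y∈ → _ , into y∈ , φ-invol _)

  *-distribˡ-∑ : {X : Set} (c : A) (xs : List X) (h : X → A) → c ⊗ ∑ xs h ≡ ∑ xs (λ x → c ⊗ h x)
  *-distribˡ-∑ c []       h = zeroʳ c
  *-distribˡ-∑ c (x ∷ xs) h = trans (distribˡ c (h x) (∑ xs h)) (cong ((c ⊗ h x) ⊕_) (*-distribˡ-∑ c xs h))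

  ∑-indicator : {X : Set} (xs : List X) (b : X → Bool) (c : A) →
                ∑ xs (λ x → if b x then c else 0#) ≡ ∑ xs (λ x → if b x then 1# else 0#) ⊗ c
  ∑-indicator []       b c = sym (zeroˡ c)
  ∑-indicator (x ∷ xs) b c with b x
  ... | true  = trans (cong₂ _⊕_ (sym (*-identityˡ c)) (∑-indicator xs b c)) (sym (distribʳ c 1# _))
  ... | false = trans (+-identityˡ _) (trans (∑-indicator xs b c) (sym (cong (_⊗ c) (+-identityˡ _))))

module ℕΣ = SemiringSum ℕP.+-*-isSemiring
module ℚΣ = SemiringSum (IsCommutativeRing.isSemiring ℚP.+-*-isCommutativeRing)
open ℕΣ using () renaming (∑ to ∑ℕ)
open ℚΣ using () renaming (∑ to ∑ℚ)

∑ℕ-≥ : {X : Set} (xs : List X) (h : X → ℕ) {x : X} → x ∈ xs → h x ≤ ∑ℕ xs h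
∑ℕ-≥ (y ∷ xs) h (here refl) = ℕP.m≤m+n (h y) _
∑ℕ-≥ (y ∷ xs) h (there x∈) = ℕP.≤-trans (∑ℕ-≥ xs h x∈) (ℕP.m≤n+m _ (h y))

length-filter : {X : Set} {P : Pred X 0ℓ} (P? : Decidable P) (xs : List X) →
                length (filter P? xs) ≡ ∑ℕ xs (λ x → if does (P? x) then 1 else 0)
length-filter P? []       = refl
length-filter P? (x ∷ xs) with does (P? x)
... | true  = cong suc (length-filter P? xs)
... | false = length-filter P? xs

∑-zero : ∀ m {g : Fin m → ℕ} → (∀ i → g i ≡ 0) → ∑[ i < m ] g i ≡ 0
∑-zero m g≡0 = trans (sum-cong-≗ g≡0) (sum-replicate-zero m)

∑-single : ∀ m {g : Fin m → ℕ} (k : Fin m) → (∀ i → i ≢ k → g i ≡ 0) → ∑[ i < m ] g i ≡ g k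
∑-single (suc m) {g} zero    g≡0 =
  trans (cong (g zero +_) (∑-zero m (λ i → g≡0 (suc i) λ ()))) (ℕP.+-identityʳ _)
∑-single (suc m) {g} (suc k) g≡0 =
  cong₂ _+_ (g≡0 zero λ ()) (∑-single m k (λ i i≢k → g≡0 (suc i) (i≢k ∘ FinP.suc-injective)))

sum-map-tabulate : {A : Set} (k : ℕ) (g : A → ℕ) (h : Fin k → A) →
                   sum (map g (List.tabulate h)) ≡ ∑[ i < k ] g (h i)
sum-map-tabulate zero    g h = refl
sum-map-tabulate (suc k) g h = cong (g (h zero) +_) (sum-map-tabulate k g (h ∘ suc))

≗-lookup⇒≡ : {A : Set} {u v : Vec A n} → (∀ i → lookup u i ≡ lookup v i) → u ≡ v
≗-lookup⇒≡ {u = u} {v} eq =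
  trans (sym (VecP.tabulate∘lookup u)) (trans (VecP.tabulate-cong eq) (VecP.tabulate∘lookup v))

lookup-∷ʳ-inject₁ : {A : Set} (xs : Vec A n) (x : A) (k : Fin n) → lookup (xs ∷ʳ x) (inject₁ k) ≡ lookup xs k
lookup-∷ʳ-inject₁ (y ∷ xs) x zero    = refl
lookup-∷ʳ-inject₁ (y ∷ xs) x (suc k) = lookup-∷ʳ-inject₁ xs x k

lookup-∷ʳ-fromℕ : {A : Set} (xs : Vec A n) (x : A) → lookup (xs ∷ʳ x) (fromℕ n) ≡ x
lookup-∷ʳ-fromℕ []       x = refl
lookup-∷ʳ-fromℕ (y ∷ xs) x = lookup-∷ʳ-fromℕ xs x

lastV-∷ʳ : (e : Vec ℕ n) (x : ℕ) → lastV (e ∷ʳ x) ≡ x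
lastV-∷ʳ []           x = refl
lastV-∷ʳ (y ∷ [])     x = refl
lastV-∷ʳ (y ∷ z ∷ e)  x = lastV-∷ʳ (z ∷ e) x

dropLastV-∷ʳ : (e : Vec ℕ n) (x : ℕ) → dropLastV (e ∷ʳ x) ≡ e
dropLastV-∷ʳ []          x = refl
dropLastV-∷ʳ (y ∷ [])    x = refl
dropLastV-∷ʳ (y ∷ z ∷ e) x = cong (y ∷_) (dropLastV-∷ʳ (z ∷ e) x)

dropLastV-∷ʳ-lastV : (e : Vec ℕ (suc n)) → dropLastV e ∷ʳ lastV e ≡ e
dropLastV-∷ʳ-lastV (x ∷ [])    = refl
dropLastV-∷ʳ-lastV (x ∷ y ∷ e) = cong (x ∷_) (dropLastV-∷ʳ-lastV (y ∷ e))

tabulate-∷ʳ : {A : Set} (h : Fin (suc n) → A) → tabulate h ≡ tabulate (h ∘ inject₁) ∷ʳ h (fromℕ n)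
tabulate-∷ʳ {n} h = ≗-lookup⇒≡ pointwise
  where
  pointwise : ∀ j → lookup (tabulate h) j ≡ lookup (tabulate (h ∘ inject₁) ∷ʳ h (fromℕ n)) j
  pointwise j with view j
  ... | ‵inject₁ k = trans (VecP.lookup∘tabulate h _)
                           (sym (trans (lookup-∷ʳ-inject₁ (tabulate (h ∘ inject₁)) _ k) (VecP.lookup∘tabulate (h ∘ inject₁) k)))
  ... | ‵fromℕ = trans (VecP.lookup∘tabulate h _) (sym (lookup-∷ʳ-fromℕ (tabulate (h ∘ inject₁)) _))

eqF-refl : (i : Fin m) → eqF i i ≡ true
eqF-refl i = dec-true (i FinP.≟ i) refl

eqF-≢ : {i j : Fin m} → i ≢ j → eqF i j ≡ false
eqF-≢ {i = i} {j} = dec-false (i FinP.≟ j)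

eqF⇒≡ : {i j : Fin m} → eqF i j ≡ true → i ≡ j
eqF⇒≡ {i = i} {j} e with i FinP.≟ j
... | yes i≡j = i≡j

actMon-summand : Vec (Fin m) m → Mon m → Fin m → Fin m → ℕ
actMon-summand σ e j i = if eqF (lookup σ i) j then lookup e i else 0

lookup-actMon : (σ : Vec (Fin m) m) (e : Mon m) (j : Fin m) →
                lookup (actMon σ e) j ≡ ∑[ i < m ] actMon-summand σ e j i
lookup-actMon {m} σ e j = trans (VecP.lookup∘tabulate _ j) (sum-map-tabulate m _ id)

lookup-actMon-preimage : (σ : Vec (Fin m) m) (e : Mon m) {j k : Fin m} → lookup σ k ≡ j →
                         (∀ i → lookup σ i ≡ j → i ≡ k) → lookup (actMon σ e) j ≡ lookup e k
lookup-actMon-preimage {m} σ e {j} {k} σk≡j unique =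
  trans (lookup-actMon σ e j) (trans (∑-single m k others) at-k)
  where
  others : ∀ i → i ≢ k → actMon-summand σ e j i ≡ 0
  others i i≢k with eqF (lookup σ i) j in eq
  ... | true  = ⊥-elim (i≢k (unique i (eqF⇒≡ eq)))
  ... | false = refl
  at-k : actMon-summand σ e j k ≡ lookup e k
  at-k rewrite σk≡j | eqF-refl j = refl

infixr 9 _∘ₚ_
_∘ₚ_ : Vec (Fin m) m → Vec (Fin m) m → Vec (Fin m) m
σ ∘ₚ τ = tabulate (λ i → lookup σ (lookup τ i))

lookup-∘ₚ : (σ τ : Vec (Fin m) m) (i : Fin m) → lookup (σ ∘ₚ τ) i ≡ lookup σ (lookup τ i)
lookup-∘ₚ σ τ = VecP.lookup∘tabulate _

actMon-∘ₚ : (σ τ : Vec (Fin m) m) (e : Mon m) → actMon σ (actMon τ e) ≡ actMon (σ ∘ₚ τ) e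
actMon-∘ₚ {m} σ τ e = ≗-lookup⇒≡ pointwise
  where
  pointwise : ∀ j → lookup (actMon σ (actMon τ e)) j ≡ lookup (actMon (σ ∘ₚ τ) e) j
  pointwise j = begin
      lookup (actMon σ (actMon τ e)) j
    ≡⟨ lookup-actMon σ (actMon τ e) j ⟩
      ∑[ i < m ] (if eqF (lookup σ i) j then lookup (actMon τ e) i else 0)
    ≡⟨ sum-cong-≗ (λ i → trans (cong (λ x → if eqF (lookup σ i) j then x else 0) (lookup-actMon τ e i))
                                (if-then-∑ (eqF (lookup σ i) j) _)) ⟩
      ∑[ i < m ] ∑[ k < m ] (if eqF (lookup σ i) j then actMon-summand τ e i k else 0)
    ≡⟨ ∑-comm {m} {m} _ ⟩
      ∑[ k < m ] ∑[ i < m ] (if eqF (lookup σ i) j then actMon-summand τ e i k else 0)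
    ≡⟨ sum-cong-≗ (λ k → ∑-single m (lookup τ k) (off-image k)) ⟩
      ∑[ k < m ] (if eqF (lookup σ (lookup τ k)) j then actMon-summand τ e (lookup τ k) k else 0)
    ≡⟨ sum-cong-≗ on-image ⟩
      ∑[ k < m ] actMon-summand (σ ∘ₚ τ) e j k
    ≡⟨ lookup-actMon (σ ∘ₚ τ) e j ⟨
      lookup (actMon (σ ∘ₚ τ) e) j
    ∎
    where
    open ≡-Reasoning
    if-then-∑ : ∀ b (h : Fin m → ℕ) → (if b then ∑[ k < m ] h k else 0) ≡ ∑[ k < m ] (if b then h k else 0)
    if-then-∑ true  h = refl
    if-then-∑ false h = sym (∑-zero m (λ _ → refl))
    off-image : ∀ k i → i ≢ lookup τ k → (if eqF (lookup σ i) j then actMon-summand τ e i k else 0) ≡ 0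
    off-image k i i≢τk with eqF (lookup σ i) j
    ... | false = refl
    ... | true rewrite eqF-≢ (i≢τk ∘ sym) = refl
    on-image : ∀ k → (if eqF (lookup σ (lookup τ k)) j then actMon-summand τ e (lookup τ k) k else 0)
                     ≡ actMon-summand (σ ∘ₚ τ) e j k
    on-image k rewrite lookup-∘ₚ σ τ k | eqF-refl (lookup τ k) = refl

transpose-matchˡ : (i j : Fin m) → transpose i j i ≡ j
transpose-matchˡ i j rewrite dec-true (i FinP.≟ i) refl = refl

transpose-matchʳ : (i j : Fin m) → transpose i j j ≡ i
transpose-matchʳ i j with j FinP.≟ i
... | yes refl = refl
... | no _ rewrite dec-true (j FinP.≟ j) refl = refl

transpose-other : {i j k : Fin m} → k ≢ i → k ≢ j → transpose i j k ≡ k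
transpose-other {i = i} {j} {k} k≢i k≢j
  rewrite dec-false (k FinP.≟ i) k≢i | dec-false (k FinP.≟ j) k≢j = refl

transpose-involutive : (i j k : Fin m) → transpose i j (transpose i j k) ≡ k
transpose-involutive i j k = cases (k FinP.≟ i) (k FinP.≟ j)
  where
  cases : Dec (k ≡ i) → Dec (k ≡ j) → transpose i j (transpose i j k) ≡ k
  cases (yes refl) _        = trans (cong (transpose k j) (transpose-matchˡ k j)) (transpose-matchʳ k j)
  cases (no _)    (yes refl) = trans (cong (transpose i k) (transpose-matchʳ i k)) (transpose-matchˡ i k)
  cases (no k≢i)  (no k≢j)   = trans (cong (transpose i j) (transpose-other k≢i k≢j)) (transpose-other k≢i k≢j)

transposition : Fin m → Fin m → Vec (Fin m) m
transposition i j = tabulate (transpose i j)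

lookup-transposition : (i j k : Fin m) → lookup (transposition i j) k ≡ transpose i j k
lookup-transposition i j = VecP.lookup∘tabulate (transpose i j)

lookup-actMon-transposition : (i j : Fin m) (e : Mon m) (k : Fin m) →
                              lookup (actMon (transposition i j) e) k ≡ lookup e (transpose i j k)
lookup-actMon-transposition i j e k = lookup-actMon-preimage (transposition i j) e
  (trans (lookup-transposition i j _) (transpose-involutive i j k))
  (λ l eq → trans (sym (transpose-involutive i j l))
                  (cong (transpose i j) (trans (sym (lookup-transposition i j l)) eq)))

actMon-transposition-involutive : (i j : Fin m) (e : Mon m) →
                                  actMon (transposition i j) (actMon (transposition i j) e) ≡ e
actMon-transposition-involutive i j e = ≗-lookup⇒≡ λ k →
  trans (lookup-actMon-transposition i j (actMon (transposition i j) e) k)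
        (trans (lookup-actMon-transposition i j e (transpose i j k)) (cong (lookup e) (transpose-involutive i j k)))

∘ₚ-transposition-involutive : (σ : Vec (Fin m) m) (i j : Fin m) →
                              (σ ∘ₚ transposition i j) ∘ₚ transposition i j ≡ σ
∘ₚ-transposition-involutive σ i j = ≗-lookup⇒≡ λ k → begin
  lookup ((σ ∘ₚ transposition i j) ∘ₚ transposition i j) k      ≡⟨ lookup-∘ₚ (σ ∘ₚ transposition i j) (transposition i j) k ⟩
  lookup (σ ∘ₚ transposition i j) (lookup (transposition i j) k) ≡⟨ lookup-∘ₚ σ (transposition i j) _ ⟩
  lookup σ (lookup (transposition i j) (lookup (transposition i j) k))
    ≡⟨ cong (lookup σ) (trans (lookup-transposition i j (lookup (transposition i j) k))
                              (trans (cong (transpose i j) (lookup-transposition i j k)) (transpose-involutive i j k))) ⟩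
  lookup σ k                                                      ∎
  where open ≡-Reasoning

actMon-transposition-fixes : (i j : Fin m) (x : Mon m) → lookup x i ≡ lookup x j → actMon (transposition i j) x ≡ x
actMon-transposition-fixes i j x xi≡xj = ≗-lookup⇒≡ λ k → trans (lookup-actMon-transposition i j x k) (cases k (k FinP.≟ i) (k FinP.≟ j))
  where
  cases : ∀ k → Dec (k ≡ i) → Dec (k ≡ j) → lookup x (transpose i j k) ≡ lookup x k
  cases k (yes refl) _        = trans (cong (lookup x) (transpose-matchˡ k j)) (sym xi≡xj)
  cases k (no _)    (yes refl) = trans (cong (lookup x) (transpose-matchʳ i k)) xi≡xj
  cases k (no k≢i)  (no k≢j)   = cong (lookup x) (transpose-other k≢i k≢j)

conjugate : Fin m → Fin m → Vec (Fin m) m → Vec (Fin m) m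
conjugate i j τ = transposition i j ∘ₚ (τ ∘ₚ transposition i j)

lookup-conjugate : (i j : Fin m) (τ : Vec (Fin m) m) (k : Fin m) →
                   lookup (conjugate i j τ) k ≡ transpose i j (lookup τ (transpose i j k))
lookup-conjugate i j τ k = trans (lookup-∘ₚ (transposition i j) (τ ∘ₚ transposition i j) k)
  (trans (lookup-transposition i j _) (cong (transpose i j) (trans (lookup-∘ₚ τ (transposition i j) k)
                                                                  (cong (lookup τ) (lookup-transposition i j k)))))

conjugate-involutive : (i j : Fin m) (τ : Vec (Fin m) m) → conjugate i j (conjugate i j τ) ≡ τ
conjugate-involutive i j τ = ≗-lookup⇒≡ λ k → begin
  lookup (conjugate i j (conjugate i j τ)) k
    ≡⟨ lookup-conjugate i j (conjugate i j τ) k ⟩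
  transpose i j (lookup (conjugate i j τ) (transpose i j k))
    ≡⟨ cong (transpose i j) (lookup-conjugate i j τ (transpose i j k)) ⟩
  transpose i j (transpose i j (lookup τ (transpose i j (transpose i j k))))
    ≡⟨ transpose-involutive i j _ ⟩
  lookup τ (transpose i j (transpose i j k))
    ≡⟨ cong (lookup τ) (transpose-involutive i j k) ⟩
  lookup τ k ∎
  where open ≡-Reasoning

actMon-conjugate : (i j : Fin m) (τ : Vec (Fin m) m) (e : Mon m) →
                   actMon (conjugate i j τ) e ≡ actMon (transposition i j) (actMon τ (actMon (transposition i j) e))
actMon-conjugate i j τ e = sym (trans (cong (actMon (transposition i j)) (actMon-∘ₚ τ (transposition i j) e))
                                      (actMon-∘ₚ (transposition i j) (τ ∘ₚ transposition i j) e))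

extend : Vec (Fin n) n → Vec (Fin (suc n)) (suc n)
extend {n} σ = Vec.map inject₁ σ ∷ʳ fromℕ n

lookup-extend-inject₁ : (σ : Vec (Fin n) n) (k : Fin n) → lookup (extend σ) (inject₁ k) ≡ inject₁ (lookup σ k)
lookup-extend-inject₁ σ k = trans (lookup-∷ʳ-inject₁ (Vec.map inject₁ σ) _ k) (VecP.lookup-map k inject₁ σ)

lookup-extend-fromℕ : (σ : Vec (Fin n) n) → lookup (extend σ) (fromℕ n) ≡ fromℕ n
lookup-extend-fromℕ σ = lookup-∷ʳ-fromℕ (Vec.map inject₁ σ) _

extend-injective : {σ τ : Vec (Fin n) n} → extend σ ≡ extend τ → σ ≡ τ
extend-injective {σ = σ} {τ} eq = ≗-lookup⇒≡ λ k → FinP.inject₁-injective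
  (trans (sym (lookup-extend-inject₁ σ k)) (trans (cong (λ v → lookup v (inject₁ k)) eq) (lookup-extend-inject₁ τ k)))

actMon-extend : (σ : Vec (Fin n) n) (e : Mon n) (x : ℕ) → actMon (extend σ) (e ∷ʳ x) ≡ actMon σ e ∷ʳ x
actMon-extend {n} σ e x = ≗-lookup⇒≡ pointwise
  where
  open ≡-Reasoning
  summand : Fin (suc n) → Fin (suc n) → ℕ
  summand = actMon-summand (extend σ) (e ∷ʳ x)
  pointwise : ∀ j → lookup (actMon (extend σ) (e ∷ʳ x)) j ≡ lookup (actMon σ e ∷ʳ x) j
  pointwise j with view j
  ... | ‵inject₁ k = begin
      lookup (actMon (extend σ) (e ∷ʳ x)) (inject₁ k)
    ≡⟨ trans (lookup-actMon (extend σ) (e ∷ʳ x) _) (sum-init-last (summand (inject₁ k))) ⟩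
      ∑[ i < n ] summand (inject₁ k) (inject₁ i) + summand (inject₁ k) (fromℕ n)
    ≡⟨ cong₂ _+_ (sum-cong-≗ old) new ⟩
      ∑[ i < n ] actMon-summand σ e k i + 0
    ≡⟨ trans (ℕP.+-identityʳ _) (sym (lookup-actMon σ e k)) ⟩
      lookup (actMon σ e) k
    ≡⟨ lookup-∷ʳ-inject₁ (actMon σ e) x k ⟨
      lookup (actMon σ e ∷ʳ x) (inject₁ k)
    ∎
    where
    old : ∀ i → summand (inject₁ k) (inject₁ i) ≡ actMon-summand σ e k i
    old i rewrite lookup-extend-inject₁ σ i | lookup-∷ʳ-inject₁ e x i
      with lookup σ i FinP.≟ k
    ... | yes refl rewrite eqF-refl (inject₁ (lookup σ i)) = refl
    ... | no ≢k rewrite eqF-≢ (≢k ∘ FinP.inject₁-injective) = refl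
    new : summand (inject₁ k) (fromℕ n) ≡ 0
    new rewrite lookup-extend-fromℕ σ | eqF-≢ (FinP.fromℕ≢inject₁ {i = k}) = refl
  ... | ‵fromℕ = begin
      lookup (actMon (extend σ) (e ∷ʳ x)) (fromℕ n)
    ≡⟨ trans (lookup-actMon (extend σ) (e ∷ʳ x) _) (sum-init-last (summand (fromℕ n))) ⟩
      ∑[ i < n ] summand (fromℕ n) (inject₁ i) + summand (fromℕ n) (fromℕ n)
    ≡⟨ cong₂ _+_ (∑-zero n old) new ⟩
      x
    ≡⟨ lookup-∷ʳ-fromℕ (actMon σ e) x ⟨
      lookup (actMon σ e ∷ʳ x) (fromℕ n)
    ∎
    where
    old : ∀ i → summand (fromℕ n) (inject₁ i) ≡ 0
    old i rewrite lookup-extend-inject₁ σ i | eqF-≢ (FinP.fromℕ≢inject₁ {i = lookup σ i} ∘ sym) = refl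
    new : summand (fromℕ n) (fromℕ n) ≡ x
    new rewrite lookup-extend-fromℕ σ | eqF-refl (fromℕ n) | lookup-∷ʳ-fromℕ e x = refl

lookup-actMon-extend-fromℕ : (σ : Vec (Fin n) n) (x : Mon (suc n)) →
                             lookup (actMon (extend σ) x) (fromℕ n) ≡ lookup x (fromℕ n)
lookup-actMon-extend-fromℕ σ x = begin
  lookup (actMon (extend σ) x) (fromℕ _)                                   ≡⟨ cong (λ y → lookup (actMon (extend σ) y) (fromℕ _)) split ⟨
  lookup (actMon (extend σ) (dropLastV x ∷ʳ lastV x)) (fromℕ _)            ≡⟨ cong (λ y → lookup y (fromℕ _)) (actMon-extend σ (dropLastV x) (lastV x)) ⟩
  lookup (actMon σ (dropLastV x) ∷ʳ lastV x) (fromℕ _)                     ≡⟨ lookup-∷ʳ-fromℕ (actMon σ (dropLastV x)) (lastV x) ⟩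
  lastV x                                                                  ≡⟨ lookup-∷ʳ-fromℕ (dropLastV x) (lastV x) ⟨
  lookup (dropLastV x ∷ʳ lastV x) (fromℕ _)                                ≡⟨ cong (λ y → lookup y (fromℕ _)) split ⟩
  lookup x (fromℕ _)                                                       ∎
  where
  open ≡-Reasoning
  split = dropLastV-∷ʳ-lastV x

lookup-extend⁻-fromℕ : (τ : Vec (Fin n) n) {i : Fin (suc n)} → lookup (extend τ) i ≡ fromℕ n → i ≡ fromℕ n
lookup-extend⁻-fromℕ τ {i} eq with view i
... | ‵fromℕ     = refl
... | ‵inject₁ k = ⊥-elim (FinP.fromℕ≢inject₁ (sym (trans (sym (lookup-extend-inject₁ τ k)) eq)))

injective⇒surjective : (σ : Vec (Fin m) m) → Injective _≡_ _≡_ (lookup σ) → ∀ j → ∃ λ i → lookup σ i ≡ j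
injective⇒surjective {m} σ inj j with FinP.any? (λ i → lookup σ i FinP.≟ j)
... | yes hit = hit
injective⇒surjective {suc m} σ inj j | no miss
  with a , b , a<b , eq ← FinP.pigeonhole (ℕP.n<1+n m) (λ i → Fin.punchOut {i = j} (λ e → miss (i , sym e)))
  = ⊥-elim (FinP.<⇒≢ a<b (inj (FinP.punchOut-injective {i = j} (λ e → miss (a , sym e)) (λ e → miss (b , sym e)) eq)))

allVecs-suc : ∀ k m → allVecs (suc k) m ≡ map (λ (v , i) → i ∷ v) (cartesianProduct (allVecs k m) (allFin m))
allVecs-suc k m = go (allVecs k m)
  where
  go : (vs : List (Vec (Fin m) k)) →
       concatMap (λ v → map (_∷ v) (allFin m)) vs ≡ map (λ (v , i) → i ∷ v) (cartesianProduct vs (allFin m))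
  go []       = refl
  go (v ∷ vs) = trans (cong₂ _++_ (ListP.map-∘ (allFin m)) (go vs))
                      (sym (ListP.map-++ _ (map (v ,_) (allFin m)) (cartesianProduct vs (allFin m))))

∈-allVecs : ∀ k m (v : Vec (Fin m) k) → v ∈ allVecs k m
∈-allVecs zero    m []      = here refl
∈-allVecs (suc k) m (i ∷ v) rewrite allVecs-suc k m =
  ∈P.∈-map⁺ _ (∈P.∈-cartesianProduct⁺ (∈-allVecs k m v) (∈P.∈-allFin i))

allVecs-unique : ∀ k m → Unique (allVecs k m)
allVecs-unique zero    m = [] ∷ []
allVecs-unique (suc k) m rewrite allVecs-suc k m =
  UniqueP.map⁺ ∷-injective (UniqueP.cartesianProduct⁺ (allVecs-unique k m) (UniqueP.allFin⁺ m))
  where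
  ∷-injective : {x y : Vec (Fin m) k × Fin m} → proj₂ x ∷ proj₁ x ≡ proj₂ y ∷ proj₁ y → x ≡ y
  ∷-injective {_ , _} {_ , _} eq with refl , refl ← VecP.∷-injective eq = refl

T-all-allFin : (p : Fin m → Bool) → Bool.T (all p (allFin m)) ⇔ (∀ i → Bool.T (p i))
T-all-allFin p = mk⇔ (AllP.tabulate⁻ ∘ AllP.all⁺ p _) (AllP.all⁻ p ∘ AllP.tabulate⁺)

T-isInjective : (σ : Vec (Fin m) m) → Bool.T (isInjective σ) ⇔ Injective _≡_ _≡_ (lookup σ)
T-isInjective σ = mk⇔ to from
  where
  to : Bool.T (isInjective σ) → Injective _≡_ _≡_ (lookup σ)
  to h {i} {j} σi≡σj with i FinP.≟ j | Equivalence.to (T-all-allFin _) (Equivalence.to (T-all-allFin _) h i) j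
  ... | yes i≡j | _ = i≡j
  ... | no _    | t rewrite σi≡σj | eqF-refl (lookup σ j) = ⊥-elim t
  from : Injective _≡_ _≡_ (lookup σ) → Bool.T (isInjective σ)
  from inj = Equivalence.from (T-all-allFin _) λ i → Equivalence.from (T-all-allFin _) λ j → pair i j
    where
    pair : ∀ i j → Bool.T (eqF i j ∨ not (eqF (lookup σ i) (lookup σ j)))
    pair i j with i FinP.≟ j
    ... | yes _   = _
    ... | no i≢j rewrite eqF-≢ (i≢j ∘ inj) = _

∈-Sym⇔ : {σ : Vec (Fin m) m} → σ ∈ Sym m ⇔ Injective _≡_ _≡_ (lookup σ)
∈-Sym⇔ {m} {σ} = mk⇔ to from
  where
  P? = λ (σ : Vec (Fin m) m) → isInjective σ BoolP.≟ true
  to : σ ∈ Sym m → Injective _≡_ _≡_ (lookup σ)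
  to σ∈ = Equivalence.to (T-isInjective σ) (Equivalence.from BoolP.T-≡ (proj₂ (∈P.∈-filter⁻ P? {xs = allVecs m m} σ∈)))
  from : Injective _≡_ _≡_ (lookup σ) → σ ∈ Sym m
  from inj = ∈P.∈-filter⁺ P? (∈-allVecs m m σ) (Equivalence.to BoolP.T-≡ (Equivalence.from (T-isInjective σ) inj))

Sym-unique : ∀ m → Unique (Sym m)
Sym-unique m = UniqueP.filter⁺ _ (allVecs-unique m m)

Preserves : (ℕ → ℕ) → Vec (Fin m) m → Set
Preserves f σ = ∀ i → f (label (lookup σ i)) ≡ f (label i)

record Stabilises (f : ℕ → ℕ) (σ : Vec (Fin m) m) : Set where
  constructor stabilises
  field
    injective  : Injective _≡_ _≡_ (lookup σ)
    preserving : Preserves f σ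

-- R m T and C m T are Stab m (rowOf T) and Stab m (colOf T) by definition.
Stab : (m : ℕ) → (ℕ → ℕ) → List (Vec (Fin m) m)
Stab m f = filter (λ σ → preserves f σ BoolP.≟ true) (Sym m)

T-preserves : (f : ℕ → ℕ) (σ : Vec (Fin m) m) → Bool.T (preserves f σ) ⇔ Preserves f σ
T-preserves f σ = mk⇔ (λ t i → ℕP.≡ᵇ⇒≡ _ _ (Equivalence.to (T-all-allFin _) t i))
                      (λ p → Equivalence.from (T-all-allFin _) (λ i → ℕP.≡⇒≡ᵇ _ _ (p i)))

∈-Stab⁻ : (f : ℕ → ℕ) {σ : Vec (Fin m) m} → σ ∈ Stab m f → Stabilises f σ
∈-Stab⁻ {m} f {σ} σ∈ with σ∈Sym , p ← ∈P.∈-filter⁻ (λ σ → preserves f σ BoolP.≟ true) {xs = Sym m} σ∈ =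
  stabilises (Equivalence.to ∈-Sym⇔ σ∈Sym) (Equivalence.to (T-preserves f σ) (Equivalence.from BoolP.T-≡ p))

∈-Stab⁺ : (f : ℕ → ℕ) {σ : Vec (Fin m) m} → Stabilises f σ → σ ∈ Stab m f
∈-Stab⁺ {m} f {σ} (stabilises inj p) = ∈P.∈-filter⁺ (λ σ → preserves f σ BoolP.≟ true) (Equivalence.from ∈-Sym⇔ inj)
  (Equivalence.to BoolP.T-≡ (Equivalence.from (T-preserves f σ) p))

Stab-unique : ∀ m f → Unique (Stab m f)
Stab-unique m f = UniqueP.filter⁺ _ (Sym-unique m)

Stabilises-∘ₚ : {f : ℕ → ℕ} {σ τ : Vec (Fin m) m} → Stabilises f σ → Stabilises f τ → Stabilises f (σ ∘ₚ τ)
Stabilises-∘ₚ {f = f} {σ} {τ} (stabilises σ-inj σ-pres) (stabilises τ-inj τ-pres) = stabilises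
  (λ {i} {j} eq → τ-inj (σ-inj (trans (sym (lookup-∘ₚ σ τ i)) (trans eq (lookup-∘ₚ σ τ j)))))
  (λ i → trans (cong (f ∘ label) (lookup-∘ₚ σ τ i)) (trans (σ-pres (lookup τ i)) (τ-pres i)))

Stabilises-transposition : {f : ℕ → ℕ} (i j : Fin m) → f (label i) ≡ f (label j) → Stabilises f (transposition i j)
Stabilises-transposition {f = f} i j fi≡fj = stabilises injective preserves′
  where
  injective : Injective _≡_ _≡_ (lookup (transposition i j))
  injective {k} {l} eq = trans (sym (transpose-involutive i j k))
    (trans (cong (transpose i j) (trans (sym (lookup-transposition i j k)) (trans eq (lookup-transposition i j l))))
           (transpose-involutive i j l))
  preserves′ : Preserves f (transposition i j)
  preserves′ k rewrite lookup-transposition i j k = cases (k FinP.≟ i) (k FinP.≟ j)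
    where
    cases : Dec (k ≡ i) → Dec (k ≡ j) → f (label (transpose i j k)) ≡ f (label k)
    cases (yes refl) _        = trans (cong (f ∘ label) (transpose-matchˡ k j)) (sym fi≡fj)
    cases (no _)    (yes refl) = trans (cong (f ∘ label) (transpose-matchʳ i k)) fi≡fj
    cases (no k≢i)  (no k≢j)   = cong (f ∘ label) (transpose-other k≢i k≢j)

Agree : (n : ℕ) → (ℕ → ℕ) → (ℕ → ℕ) → Set
Agree n g′ g = ∀ (k : Fin n) → g′ (label (inject₁ k)) ≡ g (label k)

fixes-fromℕ⇒extend : (ρ : Vec (Fin (suc n)) (suc n)) → Injective _≡_ _≡_ (lookup ρ) →
                     lookup ρ (fromℕ n) ≡ fromℕ n → ∃ λ σ → extend σ ≡ ρ
fixes-fromℕ⇒extend {n} ρ inj ρ-fix = tabulate lowered , ≗-lookup⇒≡ pointwise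
  where
  avoids : ∀ k → n ≢ toℕ (lookup ρ (inject₁ k))
  avoids k n≡ = FinP.fromℕ≢inject₁ (sym (inj (trans (FinP.toℕ-injective (trans (sym n≡) (sym (FinP.toℕ-fromℕ n))))
                                                     (sym ρ-fix))))
  lowered : Fin n → Fin n
  lowered k = Fin.lower₁ (lookup ρ (inject₁ k)) (avoids k)
  pointwise : ∀ i → lookup (extend (tabulate lowered)) i ≡ lookup ρ i
  pointwise i with view i
  ... | ‵inject₁ k = trans (lookup-extend-inject₁ (tabulate lowered) k)
                          (trans (cong inject₁ (VecP.lookup∘tabulate lowered k)) (FinP.inject₁-lower₁ _ (avoids k)))
  ... | ‵fromℕ = trans (lookup-extend-fromℕ (tabulate lowered)) (sym ρ-fix)

separated⇒fixes-fromℕ : {g′ : ℕ → ℕ} (ρ : Vec (Fin (suc n)) (suc n)) → Preserves g′ ρ →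
                        (∀ k → g′ (label (inject₁ k)) ≢ g′ (label (fromℕ n))) → lookup ρ (fromℕ n) ≡ fromℕ n
separated⇒fixes-fromℕ {n} ρ pres separated with lookup ρ (fromℕ n) | view (lookup ρ (fromℕ n)) | pres (fromℕ n)
... | _ | ‵fromℕ     | _    = refl
... | _ | ‵inject₁ k | same = ⊥-elim (separated k same)

inLastClass? : (n : ℕ) (g′ : ℕ → ℕ) (a : Fin (suc n)) → Dec (g′ (label a) ≡ g′ (label (fromℕ n)))
inLastClass? n g′ a = g′ (label a) ℕ.≟ g′ (label (fromℕ n))

lastClass : (n : ℕ) → (ℕ → ℕ) → List (Fin (suc n))
lastClass n g′ = filter (inLastClass? n g′) (allFin (suc n))

coset : Vec (Fin n) n × Fin (suc n) → Vec (Fin (suc n)) (suc n)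
coset {n} (τ , a) = extend τ ∘ₚ transposition a (fromℕ n)

coset-injective : {x y : Vec (Fin n) n × Fin (suc n)} → coset x ≡ coset y → x ≡ y
coset-injective {n} {τ , a} {τ′ , a′} eq = cong₂ _,_ τ≡τ′ a≡a′
  where
  L = fromℕ n
  lookup-coset : ∀ τ a i → lookup (coset (τ , a)) i ≡ lookup (extend τ) (transpose a L i)
  lookup-coset τ a i = trans (lookup-∘ₚ (extend τ) (transposition a L) i) (cong (lookup (extend τ)) (lookup-transposition a L i))
  a′↦L : transpose a′ L a ≡ L
  a′↦L = lookup-extend⁻-fromℕ τ′ (begin
    lookup (extend τ′) (transpose a′ L a) ≡⟨ lookup-coset τ′ a′ a ⟨
    lookup (coset (τ′ , a′)) a           ≡⟨ cong (λ ρ → lookup ρ a) eq ⟨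
    lookup (coset (τ , a)) a             ≡⟨ lookup-coset τ a a ⟩
    lookup (extend τ) (transpose a L a)  ≡⟨ cong (lookup (extend τ)) (transpose-matchˡ a L) ⟩
    lookup (extend τ) L                  ≡⟨ lookup-extend-fromℕ τ ⟩
    L                                    ∎)
    where open ≡-Reasoning
  a≡a′ : a ≡ a′
  a≡a′ = trans (sym (transpose-involutive a′ L a)) (trans (cong (transpose a′ L) a′↦L) (transpose-matchʳ a′ L))
  τ≡τ′ : τ ≡ τ′
  τ≡τ′ = extend-injective (begin
    extend τ                                              ≡⟨ ∘ₚ-transposition-involutive (extend τ) a L ⟨
    coset (τ , a) ∘ₚ transposition a L                    ≡⟨ cong₂ (λ ρ b → ρ ∘ₚ transposition b L) eq a≡a′ ⟩
    coset (τ′ , a′) ∘ₚ transposition a′ L                 ≡⟨ ∘ₚ-transposition-involutive (extend τ′) a′ L ⟩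
    extend τ′                                             ∎)
    where open ≡-Reasoning

module _ (g′ g : ℕ → ℕ) (agree : Agree n g′ g) where

  Stabilises-extend : {σ : Vec (Fin n) n} → Stabilises g σ → Stabilises g′ (extend σ)
  Stabilises-extend {σ} (stabilises σ-inj σ-pres) = stabilises injective preserves′
    where
    injective : Injective _≡_ _≡_ (lookup (extend σ))
    injective {i} {j} eq with view i | view j
    ... | ‵inject₁ k | ‵inject₁ l = cong inject₁ (σ-inj (FinP.inject₁-injective
              (trans (sym (lookup-extend-inject₁ σ k)) (trans eq (lookup-extend-inject₁ σ l)))))
    ... | ‵inject₁ k | ‵fromℕ = ⊥-elim (FinP.fromℕ≢inject₁ (sym
              (trans (sym (lookup-extend-inject₁ σ k)) (trans eq (lookup-extend-fromℕ σ)))))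
    ... | ‵fromℕ | ‵inject₁ l = ⊥-elim (FinP.fromℕ≢inject₁
              (trans (sym (lookup-extend-fromℕ σ)) (trans eq (lookup-extend-inject₁ σ l))))
    ... | ‵fromℕ | ‵fromℕ = refl
    preserves′ : Preserves g′ (extend σ)
    preserves′ i with view i
    ... | ‵inject₁ k = trans (cong (g′ ∘ label) (lookup-extend-inject₁ σ k))
                              (trans (agree (lookup σ k)) (trans (σ-pres k) (sym (agree k))))
    ... | ‵fromℕ = cong (g′ ∘ label) (lookup-extend-fromℕ σ)

  Stabilises-extend⁻ : {σ : Vec (Fin n) n} → Stabilises g′ (extend σ) → Stabilises g σ
  Stabilises-extend⁻ {σ} (stabilises inj pres) = stabilises
    (λ {k} {l} eq → FinP.inject₁-injective (inj (trans (lookup-extend-inject₁ σ k)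
                                                 (trans (cong inject₁ eq) (sym (lookup-extend-inject₁ σ l))))))
    (λ k → trans (sym (agree (lookup σ k)))
                   (trans (cong (g′ ∘ label) (sym (lookup-extend-inject₁ σ k))) (trans (pres (inject₁ k)) (agree k))))

  extend-∈-Stab : {σ : Vec (Fin n) n} → σ ∈ Stab n g → extend σ ∈ Stab (suc n) g′
  extend-∈-Stab σ∈ = ∈-Stab⁺ g′ (Stabilises-extend (∈-Stab⁻ g σ∈))

  ∈-Stab⇒extend : (∀ k → g′ (label (inject₁ k)) ≢ g′ (label (fromℕ n))) →
                {ρ : Vec (Fin (suc n)) (suc n)} → ρ ∈ Stab (suc n) g′ → ∃ λ σ → σ ∈ Stab n g × extend σ ≡ ρ
  ∈-Stab⇒extend separated {ρ} ρ∈
    with stabilises ρ-inj ρ-pres ← ∈-Stab⁻ g′ ρ∈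
    with σ , refl ← fixes-fromℕ⇒extend ρ ρ-inj (separated⇒fixes-fromℕ {g′ = g′} ρ ρ-pres separated)
    = σ , ∈-Stab⁺ g (Stabilises-extend⁻ (stabilises ρ-inj ρ-pres)) , refl

  coset-∈-Stab : {x : Vec (Fin n) n × Fin (suc n)} → x ∈ cartesianProduct (Stab n g) (lastClass n g′) →
                 coset x ∈ Stab (suc n) g′
  coset-∈-Stab {x = τ , a} x∈ with τ∈ , a∈ ← ∈P.∈-cartesianProduct⁻ (Stab n g) (lastClass n g′) x∈ =
    ∈-Stab⁺ g′ (Stabilises-∘ₚ (Stabilises-extend (∈-Stab⁻ g τ∈))
                              (Stabilises-transposition a (fromℕ n) (proj₂ (∈P.∈-filter⁻ (inLastClass? n g′) {xs = allFin (suc n)} a∈))))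

  ∈-Stab⇒coset : {ρ : Vec (Fin (suc n)) (suc n)} → ρ ∈ Stab (suc n) g′ →
                 ∃ λ x → x ∈ cartesianProduct (Stab n g) (lastClass n g′) × coset x ≡ ρ
  ∈-Stab⇒coset {ρ} ρ∈ = (σ , a) , ∈P.∈-cartesianProduct⁺ σ∈ a∈ , coset≡ρ
    where
    L = fromℕ n
    ρ-stab = ∈-Stab⁻ g′ ρ∈
    preimage = injective⇒surjective ρ (Stabilises.injective ρ-stab) L
    a = proj₁ preimage
    t = transposition a L
    same-class : g′ (label a) ≡ g′ (label L)
    same-class = trans (sym (Stabilises.preserving ρ-stab a)) (cong (g′ ∘ label) (proj₂ preimage))
    ρt-stab : Stabilises g′ (ρ ∘ₚ t)
    ρt-stab = Stabilises-∘ₚ ρ-stab (Stabilises-transposition a L same-class)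
    ρt-fixes : lookup (ρ ∘ₚ t) L ≡ L
    ρt-fixes = trans (lookup-∘ₚ ρ t L)
                     (trans (cong (lookup ρ) (trans (lookup-transposition a L L) (transpose-matchʳ a L))) (proj₂ preimage))
    restriction = fixes-fromℕ⇒extend (ρ ∘ₚ t) (Stabilises.injective ρt-stab) ρt-fixes
    σ = proj₁ restriction
    σ∈ : σ ∈ Stab n g
    σ∈ = ∈-Stab⁺ g (Stabilises-extend⁻ (subst (Stabilises g′) (sym (proj₂ restriction)) ρt-stab))
    a∈ : a ∈ lastClass n g′
    a∈ = ∈P.∈-filter⁺ (inLastClass? n g′) (∈P.∈-allFin a) same-class
    coset≡ρ : coset (σ , a) ≡ ρ
    coset≡ρ = trans (cong (_∘ₚ t) (proj₂ restriction)) (∘ₚ-transposition-involutive ρ a L)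

-- Swapping two variables whose labels lie in the same class

data ClassSwap (f : ℕ → ℕ) : Mon m → Mon m → Set where
  swap : {i j : Fin m} (e : Mon m) → f (label i) ≡ f (label j) → ClassSwap f e (actMon (transposition i j) e)

Star-invariant : {B : Set} {R : Mon m → Mon m → Set} (I : Mon m → B) →
                 (∀ {x y} → R x y → I x ≡ I y) → ∀ {x y} → Star R x y → I x ≡ I y
Star-invariant I step = fold (λ x y → I x ≡ I y) (λ r rest → trans (step r) rest) refl

module StabiliserSums {A : Set} {_⊕_ _⊗_ : Op₂ A} {0# 1# : A}
                      (isSemiring : IsSemiring _≡_ _⊕_ _⊗_ 0# 1#) where

  open SemiringSum isSemiring

  ∑-Stab-extend : (g′ g : ℕ → ℕ) → Agree n g′ g → (∀ k → g′ (label (inject₁ k)) ≢ g′ (label (fromℕ n))) →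
                  (H : Vec (Fin (suc n)) (suc n) → A) → ∑ (Stab (suc n) g′) H ≡ ∑ (Stab n g) (H ∘ extend)
  ∑-Stab-extend {n} g′ g agree separated =
    ∑-reindex (Stab-unique n g) (Stab-unique (suc n) g′) extend extend-injective
              (extend-∈-Stab g′ g agree) (∈-Stab⇒extend g′ g agree separated)

  ∑-Stab-coset : (g′ g : ℕ → ℕ) → Agree n g′ g → (H : Vec (Fin (suc n)) (suc n) → A) →
                 ∑ (Stab (suc n) g′) H ≡ ∑ (Stab n g) (λ τ → ∑ (lastClass n g′) (λ a → H (coset (τ , a))))
  ∑-Stab-coset {n} g′ g agree H = trans
    (∑-reindex (UniqueP.cartesianProduct⁺ (Stab-unique n g) (UniqueP.filter⁺ (inLastClass? n g′) (UniqueP.allFin⁺ (suc n))))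
               (Stab-unique (suc n) g′) coset coset-injective (coset-∈-Stab g′ g agree) (∈-Stab⇒coset g′ g agree) H)
    (∑-cartesianProduct (Stab n g) (lastClass n g′) (H ∘ coset))

  ∑-Stab-∘ₚ-transposition : (f : ℕ → ℕ) (i j : Fin m) → f (label i) ≡ f (label j) → (H : Vec (Fin m) m → A) →
                            ∑ (Stab m f) H ≡ ∑ (Stab m f) (λ τ → H (τ ∘ₚ transposition i j))
  ∑-Stab-∘ₚ-transposition {m} f i j same =
    ∑-involution (Stab-unique m f) (_∘ₚ transposition i j) (λ τ → ∘ₚ-transposition-involutive τ i j)
                 (λ τ∈ → ∈-Stab⁺ f (Stabilises-∘ₚ (∈-Stab⁻ f τ∈) (Stabilises-transposition i j same)))

  ∑-Stab-conjugate : (f : ℕ → ℕ) (i j : Fin m) → f (label i) ≡ f (label j) → (H : Vec (Fin m) m → A) →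
                     ∑ (Stab m f) H ≡ ∑ (Stab m f) (H ∘ conjugate i j)
  ∑-Stab-conjugate {m} f i j same =
    ∑-involution (Stab-unique m f) (conjugate i j) (conjugate-involutive i j)
                 (λ τ∈ → ∈-Stab⁺ f (Stabilises-∘ₚ t-stab (Stabilises-∘ₚ (∈-Stab⁻ f τ∈) t-stab)))
    where t-stab = Stabilises-transposition {f = f} i j same

  ∑-Stab-actMon-ClassSwap : (f : ℕ → ℕ) (H : Mon m → A) {x y : Mon m} → ClassSwap f x y →
                            ∑ (Stab m f) (λ τ → H (actMon τ x)) ≡ ∑ (Stab m f) (λ τ → H (actMon τ y))
  ∑-Stab-actMon-ClassSwap {m} f H (swap {i = i} {j = j} x same) =
    trans (∑-Stab-∘ₚ-transposition f i j same (λ τ → H (actMon τ x)))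
          (∑-cong (Stab m f) (λ {τ} _ → cong H (sym (actMon-∘ₚ τ (transposition i j) x))))

  ∑-Stab-actMon-Star : (f : ℕ → ℕ) (H : Mon m → A) {x y : Mon m} → Star (ClassSwap f) x y →
                       ∑ (Stab m f) (λ τ → H (actMon τ x)) ≡ ∑ (Stab m f) (λ τ → H (actMon τ y))
  ∑-Stab-actMon-Star f H = Star-invariant (λ x → ∑ (Stab _ f) (λ τ → H (actMon τ x))) (∑-Stab-actMon-ClassSwap f H)

open StabiliserSums ℕP.+-*-isSemiring using () renaming
  (∑-Stab-coset to ∑ℕ-Stab-coset; ∑-Stab-conjugate to ∑ℕ-Stab-conjugate)
open StabiliserSums (IsCommutativeRing.isSemiring ℚP.+-*-isCommutativeRing) using () renaming
  (∑-Stab-coset to ∑ℚ-Stab-coset; ∑-Stab-extend to ∑ℚ-Stab-extend; ∑-Stab-actMon-Star to ∑ℚ-Stab-actMon-Star)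

-- s m M T is stabiliserSize m (rowOf T) (pMon m M T) by definition.
stabiliserSize : (m : ℕ) → (ℕ → ℕ) → Mon m → ℕ
stabiliserSize m f e = length (filter (λ τ → ≡-dec ℕ._≟_ (actMon τ e) e) (Stab m f))

stabiliserSize-ClassSwap : (f : ℕ → ℕ) {x y : Mon m} → ClassSwap f x y → stabiliserSize m f x ≡ stabiliserSize m f y
stabiliserSize-ClassSwap {m} f (swap {i = i} {j = j} x same) = begin
  stabiliserSize m f x
    ≡⟨ length-filter _ (Stab m f) ⟩
  ∑ℕ (Stab m f) (λ τ → if does (≡-dec ℕ._≟_ (actMon τ x) x) then 1 else 0)
    ≡⟨ ∑ℕ-Stab-conjugate f i j same _ ⟩
  ∑ℕ (Stab m f) (λ τ → if does (≡-dec ℕ._≟_ (actMon (conjugate i j τ) x) x) then 1 else 0)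
    ≡⟨ ℕΣ.∑-cong (Stab m f) (λ {τ} _ → cong (λ b → if b then 1 else 0)
                                        (does-⇔ (fixed⇔ τ) (≡-dec ℕ._≟_ _ _) (≡-dec ℕ._≟_ _ _))) ⟩
  ∑ℕ (Stab m f) (λ τ → if does (≡-dec ℕ._≟_ (actMon τ tx) tx) then 1 else 0)
    ≡⟨ length-filter _ (Stab m f) ⟨
  stabiliserSize m f tx ∎
  where
  open ≡-Reasoning
  t = transposition i j
  tx = actMon t x
  fixed⇔ : ∀ τ → actMon (conjugate i j τ) x ≡ x ⇔ actMon τ tx ≡ tx
  fixed⇔ τ = mk⇔
    (λ eq → trans (sym (actMon-transposition-involutive i j _))
                  (cong (actMon t) (trans (sym (actMon-conjugate i j τ x)) eq)))
    (λ eq → trans (actMon-conjugate i j τ x) (trans (cong (actMon t) eq) (actMon-transposition-involutive i j x)))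

stabiliserSize-Star : (f : ℕ → ℕ) {x y : Mon m} → Star (ClassSwap f) x y → stabiliserSize m f x ≡ stabiliserSize m f y
stabiliserSize-Star f = Star-invariant (stabiliserSize _ f) (stabiliserSize-ClassSwap f)

isInversion : Vec (Fin m) m → Fin m → Fin m → Bool
isInversion σ i j = (toℕ i ℕ.<ᵇ toℕ j) ∧ (toℕ (lookup σ j) ℕ.<ᵇ toℕ (lookup σ i))

inversions-∑ : (σ : Vec (Fin m) m) → inversions σ ≡ ∑[ i < m ] ∑[ j < m ] (if isInversion σ i j then 1 else 0)
inversions-∑ {m} σ = begin
  inversions σ
    ≡⟨ length-filter _ (cartesianProduct (allFin m) (allFin m)) ⟩
  ∑ℕ (cartesianProduct (allFin m) (allFin m)) (λ (i , j) → if does (isInversion σ i j BoolP.≟ true) then 1 else 0)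
    ≡⟨ ℕΣ.∑-cartesianProduct (allFin m) (allFin m) _ ⟩
  ∑ℕ (allFin m) (λ i → ∑ℕ (allFin m) (λ j → if does (isInversion σ i j BoolP.≟ true) then 1 else 0))
    ≡⟨ sum-map-tabulate m _ id ⟩
  ∑[ i < m ] ∑ℕ (allFin m) (λ j → if does (isInversion σ i j BoolP.≟ true) then 1 else 0)
    ≡⟨ sum-cong-≗ (λ i → trans (sum-map-tabulate m _ id) (sum-cong-≗ (λ j → indicator (isInversion σ i j)))) ⟩
  ∑[ i < m ] ∑[ j < m ] (if isInversion σ i j then 1 else 0) ∎
  where
  open ≡-Reasoning
  indicator : ∀ b → (if does (b BoolP.≟ true) then 1 else 0) ≡ (if b then 1 else 0)
  indicator true  = refl
  indicator false = refl

<ᵇ-≥ : ∀ a b → b ≤ a → (a ℕ.<ᵇ b) ≡ false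
<ᵇ-≥ a b b≤a with a ℕ.<ᵇ b in eq
... | false = refl
... | true  = ⊥-elim (ℕP.<⇒≱ (ℕP.<ᵇ⇒< a b (subst Bool.T (sym eq) _)) b≤a)

inversions-extend : (σ : Vec (Fin n) n) → inversions (extend σ) ≡ inversions σ
inversions-extend {n} σ = begin
  inversions (extend σ)
    ≡⟨ inversions-∑ (extend σ) ⟩
  ∑[ i < suc n ] row i
    ≡⟨ sum-init-last row ⟩
  ∑[ i < n ] row (inject₁ i) + row (fromℕ n)
    ≡⟨ cong₂ _+_ (sum-cong-≗ old-row) (∑-zero (suc n) (λ j → cong ind (from-last j))) ⟩
  ∑[ i < n ] ∑[ j < n ] ind (isInversion σ i j) + 0
    ≡⟨ trans (ℕP.+-identityʳ _) (sym (inversions-∑ σ)) ⟩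
  inversions σ ∎
  where
  open ≡-Reasoning
  ind : Bool → ℕ
  ind b = if b then 1 else 0
  row : Fin (suc n) → ℕ
  row i = ∑[ j < suc n ] ind (isInversion (extend σ) i j)
  both-old : ∀ i j → isInversion (extend σ) (inject₁ i) (inject₁ j) ≡ isInversion σ i j
  both-old i j rewrite lookup-extend-inject₁ σ i | lookup-extend-inject₁ σ j | FinP.toℕ-inject₁ i
    | FinP.toℕ-inject₁ j | FinP.toℕ-inject₁ (lookup σ i) | FinP.toℕ-inject₁ (lookup σ j) = refl
  to-last : ∀ i → isInversion (extend σ) (inject₁ i) (fromℕ n) ≡ false
  to-last i rewrite lookup-extend-inject₁ σ i | lookup-extend-fromℕ σ | FinP.toℕ-fromℕ n
    | FinP.toℕ-inject₁ (lookup σ i) | <ᵇ-≥ n (toℕ (lookup σ i)) (ℕP.<⇒≤ (FinP.toℕ<n (lookup σ i))) = BoolP.∧-zeroʳ _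
  from-last : ∀ j → isInversion (extend σ) (fromℕ n) j ≡ false
  from-last j rewrite FinP.toℕ-fromℕ n | <ᵇ-≥ n (toℕ j) (FinP.toℕ≤pred[n] j) = refl
  old-row : ∀ i → row (inject₁ i) ≡ ∑[ j < n ] ind (isInversion σ i j)
  old-row i = trans (sum-init-last (λ j → ind (isInversion (extend σ) (inject₁ i) j)))
    (trans (cong₂ _+_ (sum-cong-≗ (λ j → cong ind (both-old i j))) (cong ind (to-last i))) (ℕP.+-identityʳ _))

sgn-extend : (σ : Vec (Fin n) n) → sgn (extend σ) ≡ sgn σ
sgn-extend σ = sgn-cong (extend σ) σ (inversions-extend σ)
  where
  sgn-cong : ∀ {m m′} (σ : Vec (Fin m) m) (σ′ : Vec (Fin m′) m′) → inversions σ ≡ inversions σ′ → sgn σ ≡ sgn σ′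
  sgn-cong σ σ′ eq with inversions σ | inversions σ′
  sgn-cong σ σ′ refl | k | .k = refl

δ : Mon m → Mon m → ℚ
δ x y = if does (≡-dec ℕ._≟_ x y) then 1ℚ else 0ℚ

δ-cong : {x y : Mon m} {x′ y′ : Mon n} → x ≡ y ⇔ x′ ≡ y′ → δ x y ≡ δ x′ y′
δ-cong x≡y⇔ = cong (λ b → if b then 1ℚ else 0ℚ) (does-⇔ x≡y⇔ (≡-dec ℕ._≟_ _ _) (≡-dec ℕ._≟_ _ _))

δ-∷ʳ : (x y : Mon m) (a : ℕ) → δ (x ∷ʳ a) (y ∷ʳ a) ≡ δ x y
δ-∷ʳ x y a = δ-cong (mk⇔ (VecP.∷ʳ-injectiveˡ x y) (cong (_∷ʳ a)))

δ-≢ : {x y : Mon m} → x ≢ y → δ x y ≡ 0ℚ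
δ-≢ {x = x} {y} x≢y rewrite dec-false (≡-dec ℕ._≟_ x y) x≢y = refl

coeff-∷ : (c : ℚ) (x : Mon m) (P : Poly m) (e : Mon m) → coeff ((c , x) ∷ P) e ≡ c ℚ.* δ x e ℚ.+ coeff P e
coeff-∷ c x P e with ≡-dec ℕ._≟_ x e
... | yes _ = cong (ℚ._+ coeff P e) (sym (ℚP.*-identityʳ c))
... | no  _ = sym (trans (cong (ℚ._+ coeff P e) (ℚP.*-zeroʳ c)) (ℚP.+-identityˡ _))

coeff-++ : (P Q : Poly m) (e : Mon m) → coeff (P ++ Q) e ≡ coeff P e ℚ.+ coeff Q e
coeff-++ []            Q e = sym (ℚP.+-identityˡ _)
coeff-++ ((c , x) ∷ P) Q e = begin
  coeff ((c , x) ∷ P ++ Q) e                       ≡⟨ coeff-∷ c x (P ++ Q) e ⟩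
  c ℚ.* δ x e ℚ.+ coeff (P ++ Q) e                 ≡⟨ cong (c ℚ.* δ x e ℚ.+_) (coeff-++ P Q e) ⟩
  c ℚ.* δ x e ℚ.+ (coeff P e ℚ.+ coeff Q e)        ≡⟨ ℚP.+-assoc (c ℚ.* δ x e) (coeff P e) (coeff Q e) ⟨
  (c ℚ.* δ x e ℚ.+ coeff P e) ℚ.+ coeff Q e        ≡⟨ cong (ℚ._+ coeff Q e) (coeff-∷ c x P e) ⟨
  coeff ((c , x) ∷ P) e ℚ.+ coeff Q e              ∎
  where open ≡-Reasoning

coeff-concatMap : {X : Set} (F : X → Poly m) (xs : List X) (e : Mon m) →
                  coeff (concatMap F xs) e ≡ ∑ℚ xs (λ x → coeff (F x) e)
coeff-concatMap F []       e = refl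
coeff-concatMap F (x ∷ xs) e =
  trans (coeff-++ (F x) (concatMap F xs) e) (cong (coeff (F x) e ℚ.+_) (coeff-concatMap F xs e))

coeff-scale : (a : ℚ) (P : Poly m) (e : Mon m) → coeff (scale a P) e ≡ a ℚ.* coeff P e
coeff-scale a []            e = sym (ℚP.*-zeroʳ a)
coeff-scale a ((c , x) ∷ P) e = begin
  coeff (scale a ((c , x) ∷ P)) e                  ≡⟨ coeff-∷ (a ℚ.* c) x (scale a P) e ⟩
  a ℚ.* c ℚ.* δ x e ℚ.+ coeff (scale a P) e        ≡⟨ cong₂ ℚ._+_ (ℚP.*-assoc a c (δ x e)) (coeff-scale a P e) ⟩
  a ℚ.* (c ℚ.* δ x e) ℚ.+ a ℚ.* coeff P e          ≡⟨ ℚP.*-distribˡ-+ a (c ℚ.* δ x e) (coeff P e) ⟨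
  a ℚ.* (c ℚ.* δ x e ℚ.+ coeff P e)                ≡⟨ cong (a ℚ.*_) (coeff-∷ c x P e) ⟨
  a ℚ.* coeff ((c , x) ∷ P) e                      ∎
  where open ≡-Reasoning

coeff-monomial : (x e : Mon m) → coeff ((1ℚ , x) ∷ []) e ≡ δ x e
coeff-monomial x e = trans (coeff-∷ 1ℚ x [] e) (trans (ℚP.+-identityʳ _) (ℚP.*-identityˡ _))

coeff-ε : (m : ℕ) (T : Filling) (x e : Mon m) →
          coeff (ε m T ((1ℚ , x) ∷ [])) e ≡ ∑ℚ (C m T) (λ σ → ∑ℚ (R m T) (λ τ → sgn σ ℚ.* δ (actMon σ (actMon τ x)) e))
coeff-ε m T x e =
  trans (coeff-concatMap _ (C m T) e) (ℚΣ.∑-cong (C m T) λ {σ} _ →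
  trans (coeff-concatMap _ (R m T) e) (ℚΣ.∑-cong (R m T) λ {τ} _ →
  trans (coeff-scale (sgn σ) ((1ℚ , actMon σ (actMon τ x)) ∷ []) e) (cong (sgn σ ℚ.*_) (coeff-monomial (actMon σ (actMon τ x)) e))))

coeff-setLastZero : (P : Poly (suc m)) (e : Mon m) → coeff (setLastZero P) e ≡ coeff P (e ∷ʳ 0)
coeff-setLastZero []            e = refl
coeff-setLastZero ((c , x) ∷ P) e with lastV x in last≡
... | zero = begin
  coeff ((c , dropLastV x) ∷ setLastZero P) e          ≡⟨ coeff-∷ c (dropLastV x) (setLastZero P) e ⟩
  c ℚ.* δ (dropLastV x) e ℚ.+ coeff (setLastZero P) e  ≡⟨ cong₂ ℚ._+_ (cong (c ℚ.*_) (δ-cong split)) (coeff-setLastZero P e) ⟩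
  c ℚ.* δ x (e ∷ʳ 0) ℚ.+ coeff P (e ∷ʳ 0)              ≡⟨ coeff-∷ c x P (e ∷ʳ 0) ⟨
  coeff ((c , x) ∷ P) (e ∷ʳ 0)                         ∎
  where
  open ≡-Reasoning
  split : dropLastV x ≡ e ⇔ x ≡ e ∷ʳ 0
  split = mk⇔ (λ eq → trans (sym (dropLastV-∷ʳ-lastV x)) (cong₂ _∷ʳ_ eq last≡))
              (λ { refl → dropLastV-∷ʳ e 0 })
... | suc k = sym (begin
  coeff ((c , x) ∷ P) (e ∷ʳ 0)                 ≡⟨ coeff-∷ c x P (e ∷ʳ 0) ⟩
  c ℚ.* δ x (e ∷ʳ 0) ℚ.+ coeff P (e ∷ʳ 0)      ≡⟨ cong (λ d → c ℚ.* d ℚ.+ coeff P (e ∷ʳ 0)) (δ-≢ last-differs) ⟩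
  c ℚ.* 0ℚ ℚ.+ coeff P (e ∷ʳ 0)                ≡⟨ trans (cong (ℚ._+ coeff P (e ∷ʳ 0)) (ℚP.*-zeroʳ c)) (ℚP.+-identityˡ _) ⟩
  coeff P (e ∷ʳ 0)                             ≡⟨ coeff-setLastZero P e ⟨
  coeff (setLastZero P) e                      ∎)
  where
  open ≡-Reasoning
  last-differs : x ≢ e ∷ʳ 0
  last-differs refl with () ← trans (sym last≡) (lastV-∷ʳ e 0)

toℚ : ℕ → ℚ
toℚ k = ℤ.+ k ℚ./ 1

toℚᵘ-/ : ∀ (i : ℤ.ℤ) d → ℚ.toℚᵘ (i ℚ./ suc d) ℚᵘ.≃ ℚᵘ.mkℚᵘ i d
toℚᵘ-/ i d = ℚP.toℚᵘ-fromℚᵘ (ℚᵘ.mkℚᵘ i d)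

toℚ-suc : ∀ k → toℚ (suc k) ≡ 1ℚ ℚ.+ toℚ k
toℚ-suc k = ℚP.toℚᵘ-injective (ℚᵘP.≃-trans (toℚᵘ-/ (ℤ.+ suc k) 0) (ℚᵘP.≃-sym
  (ℚᵘP.≃-trans (ℚP.toℚᵘ-homo-+ 1ℚ (toℚ k))
  (ℚᵘP.≃-trans (ℚᵘP.+-cong (toℚᵘ-/ (ℤ.+ 1) 0) (toℚᵘ-/ (ℤ.+ k) 0)) (ℚᵘ.*≡* numerators)))))
  where
  numerators : (ℤ.+ 1 ℤ.* ℤ.+ 1 ℤ.+ ℤ.+ k ℤ.* ℤ.+ 1) ℤ.* ℤ.+ 1 ≡ ℤ.+ suc k ℤ.* (ℤ.+ 1 ℤ.* ℤ.+ 1)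
  numerators rewrite ℤP.*-identityʳ (ℤ.+ k) = refl

inv-*-toℚ : ∀ a b → inv (suc a * suc b) ℚ.* toℚ (suc a) ≡ inv (suc b)
inv-*-toℚ a b = ℚP.toℚᵘ-injective (ℚᵘP.≃-trans (ℚP.toℚᵘ-homo-* (inv (suc a * suc b)) (toℚ (suc a)))
  (ℚᵘP.≃-trans (ℚᵘP.*-cong (toℚᵘ-/ (ℤ.+ 1) (b + a * suc b)) (toℚᵘ-/ (ℤ.+ suc a) 0))
  (ℚᵘP.≃-trans (ℚᵘ.*≡* numerators) (ℚᵘP.≃-sym (toℚᵘ-/ (ℤ.+ 1) b)))))
  where
  numerators : (ℤ.+ 1 ℤ.* ℤ.+ suc a) ℤ.* ℤ.+ suc b ≡ ℤ.+ 1 ℤ.* ℤ.+ (suc (b + a * suc b) * 1)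
  numerators = trans (cong (ℤ._* ℤ.+ suc b) (ℤP.*-identityˡ (ℤ.+ suc a)))
    (trans (sym (ℤP.pos-* (suc a) (suc b)))
    (trans (cong ℤ.+_ (sym (ℕP.*-identityʳ (suc a * suc b)))) (sym (ℤP.*-identityˡ (ℤ.+ (suc a * suc b * 1))))))

-- This also holds for s = 0, where both sides vanish because inv 0 = 0.
inv-*-cancelˡ : ∀ k s w → 1 ≤ k → inv (k * s) ℚ.* (toℚ k ℚ.* w) ≡ inv s ℚ.* w
inv-*-cancelˡ (suc k) zero    w _ rewrite ℕP.*-zeroʳ k = trans (ℚP.*-zeroˡ (toℚ (suc k) ℚ.* w)) (sym (ℚP.*-zeroˡ w))
inv-*-cancelˡ (suc k) (suc s) w _ =
  trans (sym (ℚP.*-assoc (inv (suc k * suc s)) (toℚ (suc k)) w)) (cong (ℚ._* w) (inv-*-toℚ k s))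

∑ℚ-indicator : {X : Set} (xs : List X) (b : X → Bool) (c : ℚ) →
               ∑ℚ xs (λ x → if b x then c else 0ℚ) ≡ toℚ (∑ℕ xs (λ x → if b x then 1 else 0)) ℚ.* c
∑ℚ-indicator xs b c = trans (ℚΣ.∑-indicator xs b c) (cong (ℚ._* c) (count xs))
  where
  count : (xs : List _) → ∑ℚ xs (λ x → if b x then 1ℚ else 0ℚ) ≡ toℚ (∑ℕ xs (λ x → if b x then 1 else 0))
  count []       = refl
  count (x ∷ xs) with b x
  ... | true  = trans (cong (1ℚ ℚ.+_) (count xs)) (sym (toℚ-suc (∑ℕ xs (λ x → if b x then 1 else 0))))
  ... | false = trans (ℚP.+-identityˡ _) (count xs)

Unique-++-∉ : {X : Set} (xs : List X) {y : X} {ys : List X} → Unique (xs ++ y ∷ ys) → y ∉ xs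
Unique-++-∉ (x ∷ xs) (x∉ ∷ _) (here refl) with x≢x ∷ _ ← AllP.++⁻ʳ xs x∉ = x≢x refl
Unique-++-∉ (x ∷ xs) (_ ∷ u)  (there y∈)  = Unique-++-∉ xs u y∈

Unique-++⁻ˡ : {X : Set} (xs : List X) {ys : List X} → Unique (xs ++ ys) → Unique xs
Unique-++⁻ˡ []       _         = []
Unique-++⁻ˡ (x ∷ xs) (x∉ ∷ u) = AllP.++⁻ˡ xs x∉ ∷ Unique-++⁻ˡ xs u

≡ᵇ-refl : ∀ x → (x ℕ.≡ᵇ x) ≡ true
≡ᵇ-refl x = dec-true (x ℕ.≟ x) refl

≡ᵇ-≢ : {x a : ℕ} → x ≢ a → (x ℕ.≡ᵇ a) ≡ false
≡ᵇ-≢ {x} {a} = dec-false (x ℕ.≟ a)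

≡ᵇ-true⇒≡ : {x a : ℕ} → (x ℕ.≡ᵇ a) ≡ true → x ≡ a
≡ᵇ-true⇒≡ {x} {a} eq = ℕP.≡ᵇ⇒≡ x a (subst Bool.T (sym eq) _)

member⇒∈ : ∀ xs a → member xs a ≡ true → a ∈ xs
member⇒∈ (x ∷ xs) a eq with x ℕ.≡ᵇ a in x≡a
... | true  = here (sym (≡ᵇ-true⇒≡ x≡a))
... | false = there (member⇒∈ xs a eq)

∈⇒member : ∀ {xs a} → a ∈ xs → member xs a ≡ true
∈⇒member {x ∷ xs} {a} (here refl) rewrite ≡ᵇ-refl a = refl
∈⇒member {x ∷ xs} {a} (there a∈) with x ℕ.≡ᵇ a
... | true  = refl
... | false = ∈⇒member a∈

∉⇒member : ∀ {xs a} → a ∉ xs → member xs a ≡ false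
∉⇒member {xs} {a} a∉ with member xs a in eq
... | true  = ⊥-elim (a∉ (member⇒∈ xs a eq))
... | false = refl

member-∷ʳ : ∀ r {x a} → a ≢ x → member (r ++ x ∷ []) a ≡ member r a
member-∷ʳ []      {x} {a} a≢x rewrite ≡ᵇ-≢ (a≢x ∘ sym) = refl
member-∷ʳ (y ∷ r) {x} {a} a≢x with y ℕ.≡ᵇ a
... | true  = refl
... | false = member-∷ʳ r a≢x

findIdx-++ : ∀ r ys a → member r a ≡ true → findIdx (r ++ ys) a ≡ findIdx r a
findIdx-++ (y ∷ r) ys a a∈r with y ℕ.≡ᵇ a
... | true  = refl
... | false = cong suc (findIdx-++ r ys a a∈r)

findIdx-< : ∀ r a → member r a ≡ true → findIdx r a < length r
findIdx-< (y ∷ r) a a∈r with y ℕ.≡ᵇ a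
... | true  = s≤s z≤n
... | false = s≤s (findIdx-< r a a∈r)

findIdx-∷ʳ-new : ∀ r x → member r x ≡ false → findIdx (r ++ x ∷ []) x ≡ length r
findIdx-∷ʳ-new []      x _ rewrite ≡ᵇ-refl x = refl
findIdx-∷ʳ-new (y ∷ r) x x∉r with y ℕ.≡ᵇ x
findIdx-∷ʳ-new (y ∷ r) x () | true
... | false = cong suc (findIdx-∷ʳ-new r x x∉r)

rowOf-ι : ∀ r rs {x a} → a ≢ x → rowOf ((r ++ x ∷ []) ∷ rs) a ≡ rowOf (r ∷ rs) a
rowOf-ι r rs a≢x rewrite member-∷ʳ r a≢x = refl

colOf-ι : ∀ r rs {x a} → a ≢ x → colOf ((r ++ x ∷ []) ∷ rs) a ≡ colOf (r ∷ rs) a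
colOf-ι r rs {x} {a} a≢x rewrite member-∷ʳ r a≢x with member r a in a∈r
... | true  = findIdx-++ r (x ∷ []) a a∈r
... | false = refl

colOf-ι-new : ∀ r rs x → x ∉ r → colOf ((r ++ x ∷ []) ∷ rs) x ≡ length r
colOf-ι-new r rs x x∉r rewrite ∈⇒member {r ++ x ∷ []} {x} (∈P.∈-++⁺ʳ r (here refl)) = findIdx-∷ʳ-new r x (∉⇒member x∉r)

colOf-< : ∀ rs {k} a → All (λ row → length row ≤ k) rs → 0 < k → colOf rs a < k
colOf-< []         a _              0<k = 0<k
colOf-< (row ∷ rs) a (row≤k ∷ rs≤k) 0<k with member row a in a∈row
... | true  = ℕP.<-≤-trans (findIdx-< row a a∈row) row≤k
... | false = colOf-< rs a rs≤k 0<k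

-- The association-list lookup by which entryAt is computed, with an arbitrary default.
lookupOr : List (ℕ × ℕ) → ℕ → ℕ → ℕ
lookupOr []             a d = d
lookupOr ((b , h) ∷ ps) a d = if does (b ℕ.≟ a) then h else lookupOr ps a d

lookupOr-++ : ∀ P Q c d → lookupOr (P ++ Q) c d ≡ lookupOr P c (lookupOr Q c d)
lookupOr-++ []            Q c d = refl
lookupOr-++ ((b , h) ∷ P) Q c d = cong (if does (b ℕ.≟ c) then h else_) (lookupOr-++ P Q c d)

lookupOr-∉ : ∀ P {c} d → c ∉ map proj₁ P → lookupOr P c d ≡ d
lookupOr-∉ []            d c∉ = refl
lookupOr-∉ ((b , h) ∷ P) d c∉ rewrite ≡ᵇ-≢ (c∉ ∘ here ∘ sym) = lookupOr-∉ P d (c∉ ∘ there)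

lookupOr-zip-∉ : ∀ r vs {c d} → c ∉ r → lookupOr (zip r vs) c d ≡ d
lookupOr-zip-∉ []      vs       c∉ = refl
lookupOr-zip-∉ (l ∷ r) []       c∉ = refl
lookupOr-zip-∉ (l ∷ r) (v ∷ vs) c∉ rewrite ≡ᵇ-≢ (c∉ ∘ here ∘ sym) = lookupOr-zip-∉ r vs (c∉ ∘ there)

lookupOr-zip-∷ʳ : ∀ r vs x v c d → length r ≡ length vs →
                  lookupOr (zip (r ++ x ∷ []) (vs ++ v ∷ [])) c d ≡ lookupOr (zip r vs) c (if does (x ℕ.≟ c) then v else d)
lookupOr-zip-∷ʳ []      []       x v c d _   = refl
lookupOr-zip-∷ʳ (l ∷ r) (w ∷ vs) x v c d len =
  cong (if does (l ℕ.≟ c) then w else_) (lookupOr-zip-∷ʳ r vs x v c d (ℕP.suc-injective len))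

entryAt-∷ : ∀ r mr rs ms a → entryAt (mr ∷ ms) (r ∷ rs) a ≡ lookupOr (zip r mr) a (entryAt ms rs a)
entryAt-∷ []      mr       rs ms a = refl
entryAt-∷ (l ∷ r) []       rs ms a = refl
entryAt-∷ (l ∷ r) (v ∷ mr) rs ms a = cong (if does (l ℕ.≟ a) then v else_) (entryAt-∷ r mr rs ms a)

entryAt-∉ : ∀ M T a → a ∉ concat T → entryAt M T a ≡ 0
entryAt-∉ M         []       a a∉ = refl
entryAt-∉ []        (r ∷ rs) a a∉ = refl
entryAt-∉ (mr ∷ ms) (r ∷ rs) a a∉ = trans (entryAt-∷ r mr rs ms a)
  (trans (lookupOr-zip-∉ r mr (a∉ ∘ ∈P.∈-++⁺ˡ)) (entryAt-∉ ms rs a (a∉ ∘ ∈P.∈-++⁺ʳ r)))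

pMon-∷ʳ : ∀ n M T → suc n ∉ concat T → pMon (suc n) M T ≡ pMon n M T ∷ʳ 0
pMon-∷ʳ n M T n+1∉ = trans (tabulate-∷ʳ (entryAt M T ∘ label))
  (cong₂ _∷ʳ_ (VecP.tabulate-cong (λ k → cong (entryAt M T ∘ suc) (FinP.toℕ-inject₁ k)))
              (trans (cong (entryAt M T ∘ suc) (FinP.toℕ-fromℕ n)) (entryAt-∉ M T (suc n) n+1∉)))

standard-labels : {λ′ : List ℕ} {T : Filling} {a : ℕ} → IsStandardFilling λ′ n T → a ∈ concat T → ∃ λ (k : Fin n) → label k ≡ a
standard-labels (_ , T↭) a∈ with a₀ , a₀∈ , refl ← ∈P.∈-map⁻ suc (↭P.∈-resp-↭ T↭ a∈) =
  fromℕ< (∈P.∈-upTo⁻ a₀∈) , cong suc (FinP.toℕ-fromℕ< _)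

standard-unique : {λ′ : List ℕ} {T : Filling} → IsStandardFilling λ′ n T → Unique (concat T)
standard-unique {n} (_ , T↭) =
  ↭ₛP.Unique-resp-↭ (setoid ℕ) (↭⇒↭ₛ (↭-sym T↭)) (UniqueP.map⁺ ℕP.suc-injective (UniqueP.upTo⁺ n))

colOf<length-first-row : {λ′ : List ℕ} (r : List ℕ) (rs : List (List ℕ)) → IsPartitionOf λ′ n →
                         shape (r ∷ rs) ≡ λ′ → ∀ a → colOf (r ∷ rs) a < length r
colOf<length-first-row r rs part refl a with member r a in a∈r
... | true  = findIdx-< r a a∈r
... | false with 0<r ∷ _ ← IsPartitionOf.positive part | r≥ ∷ _ ← IsPartitionOf.decreasing part
  = colOf-< rs a (AllP.map⁻ r≥) 0<r

-- Rotating the exponents along a row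

tab : (ℕ → ℕ) → Mon m
tab φ = tabulate (φ ∘ label)

label-injective : {i j : Fin m} → label i ≡ label j → i ≡ j
label-injective = FinP.toℕ-injective ∘ ℕP.suc-injective

tab-swap-adjacent : (D : ℕ → ℕ) (P Q : List (ℕ × ℕ)) (i₀ i₁ : Fin m) (v₀ v₁ : ℕ) → i₀ ≢ i₁ →
                    label i₀ ∉ map proj₁ P → label i₁ ∉ map proj₁ P →
                    tab (λ c → lookupOr (P ++ (label i₀ , v₁) ∷ (label i₁ , v₀) ∷ Q) c (D c))
                    ≡ actMon (transposition i₀ i₁) (tab (λ c → lookupOr (P ++ (label i₀ , v₀) ∷ (label i₁ , v₁) ∷ Q) c (D c)))
tab-swap-adjacent D P Q i₀ i₁ v₀ v₁ i₀≢i₁ i₀∉P i₁∉P = ≗-lookup⇒≡ λ j →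
  trans (VecP.lookup∘tabulate _ j)
        (sym (trans (lookup-actMon-transposition i₀ i₁ (tab unswapped) j)
                    (trans (VecP.lookup∘tabulate (unswapped ∘ label) (transpose i₀ i₁ j))
                           (sym (cases j (j FinP.≟ i₀) (j FinP.≟ i₁))))))
  where
  l₀ = label i₀
  l₁ = label i₁
  swapped unswapped : ℕ → ℕ
  swapped c   = lookupOr (P ++ (l₀ , v₁) ∷ (l₁ , v₀) ∷ Q) c (D c)
  unswapped c = lookupOr (P ++ (l₀ , v₀) ∷ (l₁ , v₁) ∷ Q) c (D c)
  l₀≢l₁ : l₀ ≢ l₁
  l₀≢l₁ = i₀≢i₁ ∘ label-injective
  cases : ∀ j → Dec (j ≡ i₀) → Dec (j ≡ i₁) → swapped (label j) ≡ unswapped (label (transpose i₀ i₁ j))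
  cases j (yes refl) _ rewrite transpose-matchˡ i₀ i₁
    | lookupOr-++ P ((l₀ , v₁) ∷ (l₁ , v₀) ∷ Q) l₀ (D l₀) | lookupOr-++ P ((l₀ , v₀) ∷ (l₁ , v₁) ∷ Q) l₁ (D l₁)
    | ≡ᵇ-refl l₀ | ≡ᵇ-≢ l₀≢l₁ | ≡ᵇ-refl l₁
    = trans (lookupOr-∉ P v₁ i₀∉P) (sym (lookupOr-∉ P v₁ i₁∉P))
  cases j (no j≢i₀) (yes refl) rewrite transpose-matchʳ i₀ i₁
    | lookupOr-++ P ((l₀ , v₁) ∷ (l₁ , v₀) ∷ Q) l₁ (D l₁) | lookupOr-++ P ((l₀ , v₀) ∷ (l₁ , v₁) ∷ Q) l₀ (D l₀)
    | ≡ᵇ-≢ l₀≢l₁ | ≡ᵇ-refl l₁ | ≡ᵇ-refl l₀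
    = trans (lookupOr-∉ P v₀ i₁∉P) (sym (lookupOr-∉ P v₀ i₀∉P))
  cases j (no j≢i₀) (no j≢i₁) rewrite transpose-other j≢i₀ j≢i₁
    | lookupOr-++ P ((l₀ , v₁) ∷ (l₁ , v₀) ∷ Q) (label j) (D (label j))
    | lookupOr-++ P ((l₀ , v₀) ∷ (l₁ , v₁) ∷ Q) (label j) (D (label j))
    | ≡ᵇ-≢ (j≢i₀ ∘ label-injective ∘ sym) | ≡ᵇ-≢ (j≢i₁ ∘ label-injective ∘ sym) = refl

InClass : (m : ℕ) → (ℕ → ℕ) → ℕ → ℕ → Set
InClass m f r a = ∃ λ (i : Fin m) → label i ≡ a × f a ≡ r

-- Rotate the values after the first label, then swap the first two values.
rotate-row : (f : ℕ → ℕ) (r : ℕ) (D : ℕ → ℕ) (P : List (ℕ × ℕ)) (ls vs : List ℕ) →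
             length ls ≡ suc (length vs) → Unique (map proj₁ P ++ ls) → All (InClass m f r) ls →
             Star (ClassSwap f) (tab {m} (λ c → lookupOr (P ++ zip ls (vs ++ 0 ∷ [])) c (D c)))
                                (tab {m} (λ c → lookupOr (P ++ zip ls (0 ∷ vs)) c (D c)))
rotate-row f r D P (l ∷ [])    []       _   _ _ = Star.ε
rotate-row {m} f r D P (_ ∷ _ ∷ ls) (v ∷ vs) len u ((i₀ , refl , fi₀) ∷ (i₁ , refl , fi₁) ∷ cls) =
  subst₂ (Star (ClassSwap f)) (shifted (vs ++ 0 ∷ [])) (shifted (0 ∷ vs)) rotated ◅◅ (swapped ◅ Star.ε)
  where
  P′ = P ++ (label i₀ , v) ∷ []
  u′ : Unique ((map proj₁ P ++ label i₀ ∷ []) ++ label i₁ ∷ ls)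
  u′ = subst Unique (sym (ListP.++-assoc (map proj₁ P) (label i₀ ∷ []) (label i₁ ∷ ls))) u
  l₁∉ : label i₁ ∉ map proj₁ P ++ label i₀ ∷ []
  l₁∉ = Unique-++-∉ (map proj₁ P ++ label i₀ ∷ []) u′
  rotated : Star (ClassSwap f) (tab {m} (λ c → lookupOr (P′ ++ zip (label i₁ ∷ ls) (vs ++ 0 ∷ [])) c (D c)))
                               (tab {m} (λ c → lookupOr (P′ ++ zip (label i₁ ∷ ls) (0 ∷ vs)) c (D c)))
  rotated = rotate-row f r D P′ (label i₁ ∷ ls) vs (ℕP.suc-injective len)
                       (subst (λ ks → Unique (ks ++ label i₁ ∷ ls)) (sym (ListP.map-++ proj₁ P _)) u′)
                       ((i₁ , refl , fi₁) ∷ cls)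
  shifted : ∀ ws → tab {m} (λ c → lookupOr (P′ ++ zip (label i₁ ∷ ls) ws) c (D c))
                   ≡ tab {m} (λ c → lookupOr (P ++ zip (label i₀ ∷ label i₁ ∷ ls) (v ∷ ws)) c (D c))
  shifted ws = VecP.tabulate-cong λ j → cong (λ Z → lookupOr Z (label j) (D (label j))) (ListP.++-assoc P _ _)
  swapped : ClassSwap f (tab {m} (λ c → lookupOr (P ++ zip (label i₀ ∷ label i₁ ∷ ls) (v ∷ 0 ∷ vs)) c (D c)))
                        (tab {m} (λ c → lookupOr (P ++ zip (label i₀ ∷ label i₁ ∷ ls) (0 ∷ v ∷ vs)) c (D c)))
  swapped = subst (ClassSwap f _)
    (sym (tab-swap-adjacent D P (zip ls vs) i₀ i₁ v 0 (λ { refl → l₁∉ (∈P.∈-++⁺ʳ _ (here refl)) })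
                            (Unique-++-∉ (map proj₁ P) u) (l₁∉ ∘ ∈P.∈-++⁺ˡ)))
    (swap _ (trans fi₀ (sym fi₁)))

-- Adding a box to the first row

module ExtendFirstRow
  (n : ℕ) (r : List ℕ) (rs : List (List ℕ)) (mr : List ℕ) (ms : List (List ℕ))
  (r≡mr : length r ≡ length mr)
  (n+1∉T : suc n ∉ r ++ concat rs)
  (r-unique : Unique r)
  (r-labels : ∀ {a} → a ∈ r → ∃ λ (k : Fin n) → label k ≡ a)
  (colOf<length-r : ∀ (k : Fin n) → colOf (r ∷ rs) (label k) < length r)
  where

  -- Tι and Mι are ι n T and ιhat M by definition.
  private
    T M Tι Mι : Filling
    T  = r ∷ rs
    M  = mr ∷ ms
    Tι = (r ++ suc n ∷ []) ∷ rs
    Mι = (0 ∷ mr) ∷ ms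
    L : Fin (suc n)
    L = fromℕ n
    f fι : Mon (suc n)
    f  = pMon (suc n) M T
    fι = pMon (suc n) Mι Tι
    f₀ : Mon n
    f₀ = pMon n M T
    n+1∉r : suc n ∉ r
    n+1∉r = n+1∉T ∘ ∈P.∈-++⁺ˡ

  label-inject₁ : (k : Fin n) → label (inject₁ k) ≡ label k
  label-inject₁ k = cong suc (FinP.toℕ-inject₁ k)

  label-inject₁≢ : (k : Fin n) → label (inject₁ k) ≢ suc n
  label-inject₁≢ k eq = FinP.toℕ-inject₁-≢ k (sym (ℕP.suc-injective eq))

  label-fromℕ : label L ≡ suc n
  label-fromℕ = cong suc (FinP.toℕ-fromℕ n)

  rows-agree : Agree n (rowOf Tι) (rowOf T)
  rows-agree k = trans (rowOf-ι r rs (label-inject₁≢ k)) (cong (rowOf T) (label-inject₁ k))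

  cols-agree : Agree n (colOf Tι) (colOf T)
  cols-agree k = trans (colOf-ι r rs (label-inject₁≢ k)) (cong (colOf T) (label-inject₁ k))

  new-column : ∀ k → colOf Tι (label (inject₁ k)) ≢ colOf Tι (label L)
  new-column k eq = ℕP.<-irrefl col≡ (colOf<length-r k)
    where
    col≡ : colOf T (label k) ≡ length r
    col≡ = trans (sym (cols-agree k)) (trans eq (trans (cong (colOf Tι) label-fromℕ) (colOf-ι-new r rs (suc n) n+1∉r)))

  f≡f₀∷ʳ0 : f ≡ f₀ ∷ʳ 0
  f≡f₀∷ʳ0 = pMon-∷ʳ n M T n+1∉T

  f-last : lookup f L ≡ 0
  f-last = trans (cong (λ v → lookup v L) f≡f₀∷ʳ0) (lookup-∷ʳ-fromℕ f₀ 0)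

  rotation : Star (ClassSwap (rowOf Tι)) f fι
  rotation = subst₂ (Star (ClassSwap (rowOf Tι))) (sym f≡rotated) (sym fι≡rotated)
    (rotate-row (rowOf Tι) 0 D [] (r ++ suc n ∷ []) mr length-row row-unique (All.tabulate in-first-row))
    where
    D : ℕ → ℕ
    D = entryAt ms rs
    length-row : length (r ++ suc n ∷ []) ≡ suc (length mr)
    length-row = trans (ListP.length-++ r) (trans (ℕP.+-comm (length r) 1) (cong suc r≡mr))
    row-unique : Unique (r ++ suc n ∷ [])
    row-unique = UniqueP.++⁺ r-unique ([] ∷ []) λ { (n+1∈r , here refl) → n+1∉r n+1∈r }
    in-first-row : ∀ {a} → a ∈ r ++ suc n ∷ [] → InClass (suc n) (rowOf Tι) 0 a
    in-first-row {a} a∈ with ∈P.∈-++⁻ r a∈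
    ... | inj₁ a∈r with k , refl ← r-labels a∈r = inject₁ k , label-inject₁ k , row0
      where row0 : rowOf Tι a ≡ 0
            row0 rewrite ∈⇒member a∈ = refl
    ... | inj₂ (here refl) = L , label-fromℕ , row0
      where row0 : rowOf Tι a ≡ 0
            row0 rewrite ∈⇒member a∈ = refl
    f≡rotated : f ≡ tab (λ c → lookupOr (zip (r ++ suc n ∷ []) (mr ++ 0 ∷ [])) c (D c))
    f≡rotated = VecP.tabulate-cong λ i → trans (entryAt-∷ r mr rs ms (label i))
      (sym (trans (lookupOr-zip-∷ʳ r mr (suc n) 0 (label i) (D (label i)) r≡mr) (new-entry (label i))))
      where
      new-entry : ∀ c → lookupOr (zip r mr) c (if does (suc n ℕ.≟ c) then 0 else D c) ≡ lookupOr (zip r mr) c (D c)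
      new-entry c with suc n ℕ.≡ᵇ c in n+1≡ᵇc
      ... | false = refl
      ... | true with refl ← ≡ᵇ-true⇒≡ {suc n} {c} n+1≡ᵇc = trans (lookupOr-zip-∉ r mr n+1∉r)
          (sym (trans (lookupOr-zip-∉ r mr n+1∉r) (entryAt-∉ ms rs (suc n) (n+1∉T ∘ ∈P.∈-++⁺ʳ r))))
    fι≡rotated : fι ≡ tab (λ c → lookupOr (zip (r ++ suc n ∷ []) (0 ∷ mr)) c (D c))
    fι≡rotated = VecP.tabulate-cong λ i → entryAt-∷ (r ++ suc n ∷ []) (0 ∷ mr) rs ms (label i)

  ε-rotation : ∀ e → coeff (ε (suc n) Tι ((1ℚ , fι) ∷ [])) e ≡ coeff (ε (suc n) Tι ((1ℚ , f) ∷ [])) e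
  ε-rotation e = trans (coeff-ε (suc n) Tι fι e) (trans
    (ℚΣ.∑-cong (C (suc n) Tι) (λ {σ} _ → sym (∑ℚ-Stab-actMon-Star (rowOf Tι) (λ x → sgn σ ℚ.* δ (actMon σ x) e) rotation)))
    (sym (coeff-ε (suc n) Tι f e)))

  lookup-coset-fromℕ : (τ : Vec (Fin n) n) (a : Fin (suc n)) → lookup (actMon (coset (τ , a)) f) L ≡ lookup f a
  lookup-coset-fromℕ τ a = begin
    lookup (actMon (coset (τ , a)) f) L                                ≡⟨ cong (λ x → lookup x L) (actMon-∘ₚ (extend τ) t f) ⟨
    lookup (actMon (extend τ) (actMon t f)) L                          ≡⟨ lookup-actMon-extend-fromℕ τ (actMon t f) ⟩
    lookup (actMon t f) L                                              ≡⟨ lookup-actMon-transposition a L f L ⟩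
    lookup f (transpose a L L)                                         ≡⟨ cong (lookup f) (transpose-matchʳ a L) ⟩
    lookup f a                                                         ∎
    where
    open ≡-Reasoning
    t = transposition a L

  actMon-coset-zero : (τ : Vec (Fin n) n) (a : Fin (suc n)) → lookup f a ≡ 0 → actMon (coset (τ , a)) f ≡ actMon τ f₀ ∷ʳ 0
  actMon-coset-zero τ a fa≡0 = begin
    actMon (coset (τ , a)) f                                           ≡⟨ actMon-∘ₚ (extend τ) t f ⟨
    actMon (extend τ) (actMon t f)                                     ≡⟨ cong (actMon (extend τ)) (actMon-transposition-fixes a L f (trans fa≡0 (sym f-last))) ⟩
    actMon (extend τ) f                                                ≡⟨ cong (actMon (extend τ)) f≡f₀∷ʳ0 ⟩
    actMon (extend τ) (f₀ ∷ʳ 0)                                        ≡⟨ actMon-extend τ f₀ 0 ⟩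
    actMon τ f₀ ∷ʳ 0                                                   ∎
    where
    open ≡-Reasoning
    t = transposition a L

  zero? : Fin (suc n) → Bool
  zero? a = lookup f a ℕ.≡ᵇ 0

  zeroCount : ℕ
  zeroCount = ∑ℕ (lastClass n (rowOf Tι)) (λ a → if zero? a then 1 else 0)

  1≤zeroCount : 1 ≤ zeroCount
  1≤zeroCount = ℕP.≤-trans (ℕP.≤-reflexive (sym L-counted)) (∑ℕ-≥ (lastClass n (rowOf Tι)) _ L∈)
    where
    L∈ : L ∈ lastClass n (rowOf Tι)
    L∈ = ∈P.∈-filter⁺ (inLastClass? n (rowOf Tι)) (∈P.∈-allFin L) refl
    L-counted : (if zero? L then 1 else 0) ≡ 1
    L-counted rewrite f-last = refl

  coset-term : (σ τ : Vec (Fin n) n) (a : Fin (suc n)) (e : Mon n) →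
               sgn (extend σ) ℚ.* δ (actMon (extend σ) (actMon (coset (τ , a)) f)) (e ∷ʳ 0)
               ≡ (if zero? a then sgn σ ℚ.* δ (actMon σ (actMon τ f₀)) e else 0ℚ)
  coset-term σ τ a e with lookup f a in fa≡0
  ... | zero = cong₂ ℚ._*_ (sgn-extend σ) (trans
        (cong (λ x → δ (actMon (extend σ) x) (e ∷ʳ 0)) (actMon-coset-zero τ a fa≡0))
        (trans (cong (λ x → δ x (e ∷ʳ 0)) (actMon-extend σ (actMon τ f₀) 0))
               (δ-∷ʳ (actMon σ (actMon τ f₀)) e 0)))
  ... | suc _ = trans (cong (sgn (extend σ) ℚ.*_) (δ-≢ last-differs)) (ℚP.*-zeroʳ (sgn (extend σ)))
    where
    last-differs : actMon (extend σ) (actMon (coset (τ , a)) f) ≢ e ∷ʳ 0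
    last-differs eq with () ← trans (sym fa≡0) (trans (sym (lookup-coset-fromℕ τ a))
      (trans (sym (lookup-actMon-extend-fromℕ σ (actMon (coset (τ , a)) f))) (trans (cong (λ x → lookup x L) eq) (lookup-∷ʳ-fromℕ e 0))))

  coset-fixes : (τ : Vec (Fin n) n) (a : Fin (suc n)) →
                (if does (≡-dec ℕ._≟_ (actMon (coset (τ , a)) f) f) then 1 else 0)
                ≡ (if zero? a then (if does (≡-dec ℕ._≟_ (actMon τ f₀) f₀) then 1 else 0) else 0)
  coset-fixes τ a with lookup f a in fa≡0
  ... | zero = cong (λ b → if b then 1 else 0) (does-⇔ fixes⇔ (≡-dec ℕ._≟_ _ _) (≡-dec ℕ._≟_ _ _))
    where
    fixes⇔ : actMon (coset (τ , a)) f ≡ f ⇔ actMon τ f₀ ≡ f₀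
    fixes⇔ = mk⇔ (λ eq → VecP.∷ʳ-injectiveˡ _ _ (trans (sym (actMon-coset-zero τ a fa≡0)) (trans eq f≡f₀∷ʳ0)))
                 (λ eq → trans (actMon-coset-zero τ a fa≡0) (trans (cong (_∷ʳ 0) eq) (sym f≡f₀∷ʳ0)))
  ... | suc _ = cong (λ b → if b then 1 else 0) (dec-false (≡-dec ℕ._≟_ _ _) moved)
    where
    moved : actMon (coset (τ , a)) f ≢ f
    moved eq with () ← trans (sym fa≡0) (trans (sym (lookup-coset-fromℕ τ a)) (trans (cong (λ x → lookup x L) eq) f-last))

  ε-setLastZero : ∀ e → coeff (ε (suc n) Tι ((1ℚ , f) ∷ [])) (e ∷ʳ 0) ≡ toℚ zeroCount ℚ.* coeff (ε n T ((1ℚ , f₀) ∷ [])) e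
  ε-setLastZero e = begin
    coeff (ε (suc n) Tι ((1ℚ , f) ∷ [])) (e ∷ʳ 0)
      ≡⟨ coeff-ε (suc n) Tι f (e ∷ʳ 0) ⟩
    ∑ℚ (C (suc n) Tι) (λ σ → ∑ℚ (R (suc n) Tι) (λ ρ → sgn σ ℚ.* δ (actMon σ (actMon ρ f)) (e ∷ʳ 0)))
      ≡⟨ ∑ℚ-Stab-extend (colOf Tι) (colOf T) cols-agree new-column _ ⟩
    ∑ℚ (C n T) (λ σ → ∑ℚ (R (suc n) Tι) (λ ρ → sgn (extend σ) ℚ.* δ (actMon (extend σ) (actMon ρ f)) (e ∷ʳ 0)))
      ≡⟨ ℚΣ.∑-cong (C n T) (λ _ → ∑ℚ-Stab-coset (rowOf Tι) (rowOf T) rows-agree _) ⟩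
    ∑ℚ (C n T) (λ σ → ∑ℚ (R n T) (λ τ → ∑ℚ A (λ a → sgn (extend σ) ℚ.* δ (actMon (extend σ) (actMon (coset (τ , a)) f)) (e ∷ʳ 0))))
      ≡⟨ ℚΣ.∑-cong (C n T) (λ {σ} _ → ℚΣ.∑-cong (R n T) λ {τ} _ →
           trans (ℚΣ.∑-cong A (λ {a} _ → coset-term σ τ a e)) (∑ℚ-indicator A zero? _)) ⟩
    ∑ℚ (C n T) (λ σ → ∑ℚ (R n T) (λ τ → toℚ zeroCount ℚ.* (sgn σ ℚ.* δ (actMon σ (actMon τ f₀)) e)))
      ≡⟨ ℚΣ.∑-cong (C n T) (λ {σ} _ → sym (ℚΣ.*-distribˡ-∑ (toℚ zeroCount) (R n T) _)) ⟩
    ∑ℚ (C n T) (λ σ → toℚ zeroCount ℚ.* ∑ℚ (R n T) (λ τ → sgn σ ℚ.* δ (actMon σ (actMon τ f₀)) e))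
      ≡⟨ ℚΣ.*-distribˡ-∑ (toℚ zeroCount) (C n T) _ ⟨
    toℚ zeroCount ℚ.* ∑ℚ (C n T) (λ σ → ∑ℚ (R n T) (λ τ → sgn σ ℚ.* δ (actMon σ (actMon τ f₀)) e))
      ≡⟨ cong (toℚ zeroCount ℚ.*_) (coeff-ε n T f₀ e) ⟨
    toℚ zeroCount ℚ.* coeff (ε n T ((1ℚ , f₀) ∷ [])) e ∎
    where
    open ≡-Reasoning
    A = lastClass n (rowOf Tι)

  s-ιhat-ι : s (suc n) Mι Tι ≡ zeroCount * s n M T
  s-ιhat-ι = begin
    stabiliserSize (suc n) (rowOf Tι) fι
      ≡⟨ stabiliserSize-Star (rowOf Tι) rotation ⟨
    stabiliserSize (suc n) (rowOf Tι) f
      ≡⟨ length-filter _ (R (suc n) Tι) ⟩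
    ∑ℕ (R (suc n) Tι) (λ ρ → fixes ρ f)
      ≡⟨ ∑ℕ-Stab-coset (rowOf Tι) (rowOf T) rows-agree _ ⟩
    ∑ℕ (R n T) (λ τ → ∑ℕ A (λ a → fixes (coset (τ , a)) f))
      ≡⟨ ℕΣ.∑-cong (R n T) (λ {τ} _ → trans (ℕΣ.∑-cong A (λ {a} _ → coset-fixes τ a)) (ℕΣ.∑-indicator A zero? _)) ⟩
    ∑ℕ (R n T) (λ τ → zeroCount * fixes τ f₀)
      ≡⟨ ℕΣ.*-distribˡ-∑ zeroCount (R n T) _ ⟨
    zeroCount * ∑ℕ (R n T) (λ τ → fixes τ f₀)
      ≡⟨ cong (zeroCount *_) (length-filter _ (R n T)) ⟨
    zeroCount * stabiliserSize n (rowOf T) f₀ ∎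
    where
    open ≡-Reasoning
    A = lastClass n (rowOf Tι)
    fixes : ∀ {m} → Vec (Fin m) m → Mon m → ℕ
    fixes τ x = if does (≡-dec ℕ._≟_ (actMon τ x) x) then 1 else 0

  F-ιhat-ι : F (suc n) Mι Tι ≈P scale (inv (s (suc n) Mι Tι)) (ε (suc n) Tι (p (suc n) M T))
  F-ιhat-ι e = trans (coeff-scale s⁻¹ (ε (suc n) Tι (p (suc n) Mι Tι)) e)
    (trans (cong (s⁻¹ ℚ.*_) (ε-rotation e)) (sym (coeff-scale s⁻¹ (ε (suc n) Tι (p (suc n) M T)) e)))
    where s⁻¹ = inv (s (suc n) Mι Tι)

  setLastZero-F-ιhat-ι : setLastZero (F (suc n) Mι Tι) ≈P F n M T
  setLastZero-F-ιhat-ι e = begin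
    coeff (setLastZero (F (suc n) Mι Tι)) e
      ≡⟨ coeff-setLastZero (F (suc n) Mι Tι) e ⟩
    coeff (F (suc n) Mι Tι) (e ∷ʳ 0)
      ≡⟨ F-ιhat-ι (e ∷ʳ 0) ⟩
    coeff (scale (inv (s (suc n) Mι Tι)) (ε (suc n) Tι (p (suc n) M T))) (e ∷ʳ 0)
      ≡⟨ coeff-scale (inv (s (suc n) Mι Tι)) (ε (suc n) Tι (p (suc n) M T)) (e ∷ʳ 0) ⟩
    inv (s (suc n) Mι Tι) ℚ.* coeff (ε (suc n) Tι (p (suc n) M T)) (e ∷ʳ 0)
      ≡⟨ cong₂ (λ k w → inv k ℚ.* w) s-ιhat-ι (ε-setLastZero e) ⟩
    inv (zeroCount * s n M T) ℚ.* (toℚ zeroCount ℚ.* W)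
      ≡⟨ inv-*-cancelˡ zeroCount (s n M T) W 1≤zeroCount ⟩
    inv (s n M T) ℚ.* W
      ≡⟨ coeff-scale (inv (s n M T)) (ε n T (p n M T)) e ⟨
    coeff (F n M T) e ∎
    where
    open ≡-Reasoning
    W = coeff (ε n T (p n M T)) e

proposition3p22 : (n : ℕ) (λ′ : List ℕ) (M T : Filling) →
    IsPartitionOf λ′ n → IsSSYT λ′ M → IsStandardFilling λ′ n T →
    (F (suc n) (ιhat M) (ι n T) ≈P scale (inv (s (suc n) (ιhat M) (ι n T))) (ε (suc n) (ι n T) (p (suc n) M T)))
    × (setLastZero (F (suc n) (ιhat M) (ι n T)) ≈P F n M T)
-- For T = [] (so n = 0) everything agrees definitionally with the case of the filling [ [] ].
proposition3p22 n _ [] [] _ _ (_ , T↭)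
  with refl ← trans (↭P.↭-length T↭) (trans (ListP.length-map suc (upTo n)) (ListP.length-upTo n))
  = F-ιhat-ι , setLastZero-F-ιhat-ι
  where open ExtendFirstRow 0 [] [] [] [] refl (λ ()) [] (λ ()) (λ ())
proposition3p22 n _ []        (_ ∷ _)  _ (refl , _) (() , _)
proposition3p22 n _ (_ ∷ _)   []       _ (refl , _) (() , _)
proposition3p22 n λ′ (mr ∷ ms) (r ∷ rs) part (shape-M , _) std = F-ιhat-ι , setLastZero-F-ιhat-ι
  where
  n+1∉T : suc n ∉ r ++ concat rs
  n+1∉T n+1∈ with k , label-k≡n+1 ← standard-labels std n+1∈ =
    ℕP.<-irrefl (ℕP.suc-injective label-k≡n+1) (FinP.toℕ<n k)
  open ExtendFirstRow n r rs mr ms (sym (proj₁ (ListP.∷-injective (trans shape-M (sym (proj₁ std)))))) n+1∉T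
    (Unique-++⁻ˡ r (standard-unique std)) (standard-labels std ∘ ∈P.∈-++⁺ˡ)
    (λ k → colOf<length-first-row r rs part (proj₁ std) (label k))
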